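{- Let $\alpha=\alpha(n)=O(n)$, let $p=p(n)$ be admissible, and for each $n$ let $t=t_n$ be an $\alpha$-almost supermagic edge labeling of $K_n$. Suppose that for each $n$ there is a decomposition of $[\epsilon]$ into $m\ge0$ pairwise disjoint 1-APs $I_1,\dots,I_m$, each of length at least $4p$, such that for every vertex $v$ and every $i\in[m]$, $|S(t,v)\cap I_i|\le 2$. Then for any constant integer $h>0$ there exists $p^*=p^*(n)\in[p-h+1,p]$ such that $r(p^*,t)\ge 1-\frac{3}{2h}$.
   Context: $K_n$ is the complete graph on $n$ vertices with edge set $E$, $\epsilon=\binom n2$, $[a]=\{1,\dots,a\}$, $[a,b]=\{a,\dots,b\}$; a 1-AP is a set of consecutive integers. $D(v)$ is the set of edges containing vertex $v$. An edge labeling is a bijection $t:E\to[\epsilon]$; $S(t,v)=\{t(e):e\in D(v)\}$, $s(t,v)=\sum_{e\in D(v)}t(e)$. $t$ is $\alpha$-almost supermagic if $|s(t,u)-s(t,v)|\le\alpha$ for all $u,v$. A $p$-swap of $t$ is a map $\theta$ sending $t$ to another edge labeling $\theta t$ with $|t(e)-\theta t(e)|\le p$ for all $e$. $R(p,t,n)=\max_{\theta}\max_{u\ne v}|s(\theta t,u)-s(\theta t,v)|$ over $p$-swaps $\theta$; $r(p,t)=\limsup_{n\to\infty}R(p,t_n,n)/(2pn)$. $p=p(n)$ is admissible if $p=o(n)$ and $p\to\infty$. -}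

module Defs where

open import Data.Nat as ℕ using (ℕ; zero; suc; _+_; _*_; _≤_; ∣_-_∣)
open import Data.Nat.Combinatorics using (_C_)
open import Data.Fin as Fin using (Fin; toℕ)
open import Data.Fin.Properties using (<-cmp)
open import Data.Product using (Σ; ∃; _×_; _,_; proj₁)
open import Data.Bool using (if_then_else_)
open import Relation.Nullary using (¬_; Dec; yes; no)
open import Relation.Nullary.Decidable using (⌊_⌋; _×-dec_)
open import Relation.Binary using (tri<; tri≈; tri>)
open import Relation.Binary.PropositionalEquality using (_≡_; _≢_)
open import Function.Bundles using (_⤖_; Bijection)
open import Data.Integer using (+_)
open import Data.Rational as ℚ using (ℚ)

-- The complete graph K_n: vertices Fin n, edges = unordered pairs {i,j},
-- i ≠ j, represented canonically as (i , j) with i < j.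

Edge : ℕ → Set
Edge n = Σ (Fin n) λ i → Σ (Fin n) λ j → i Fin.< j

numEdges : ℕ → ℕ
numEdges n = n C 2

-- An edge labeling: a bijection E → [ε].  We use a bijection
-- E ⤖ Fin ε, and the label of e is  1 + (index of e), so labels are
-- exactly [1, ε].
Labeling : ℕ → Set
Labeling n = Edge n ⤖ Fin (numEdges n)

label : ∀ {n} → Labeling n → Edge n → ℕ
label t e = suc (toℕ (Bijection.to t e))

-- label of the edge {u,v}; 0 when u = v (no edge).
lab : ∀ {n} → Labeling n → Fin n → Fin n → ℕ
lab t u v with <-cmp u v
... | tri< u<v _ _ = label t (u , v , u<v)
... | tri≈ _ _ _   = 0
... | tri> _ _ v<u = label t (v , u , v<u)

ΣFin : (n : ℕ) → (Fin n → ℕ) → ℕ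
ΣFin zero    f = 0
ΣFin (suc n) f = f Fin.zero + ΣFin n (λ i → f (Fin.suc i))

s : ∀ {n} → Labeling n → Fin n → ℕ
s {n} t v = ΣFin n (λ u → lab t u v)

_∈S[_,_] : ∀ {n} → ℕ → Labeling n → Fin n → Set
k ∈S[ t , v ] = ∃ λ u → (u ≢ v) × (lab t u v ≡ k)

AlmostSupermagic : ∀ {n} → ℕ → Labeling n → Set
AlmostSupermagic {n} α t = ∀ (u v : Fin n) → ∣ s t u - s t v ∣ ≤ α

IsPSwapOf : ∀ {n} → ℕ → Labeling n → Labeling n → Set
IsPSwapOf {n} p t t' = ∀ (e : Edge n) → ∣ label t e - label t' e ∣ ≤ p

-- 1-APs: the interval [a, a + ℓ − 1] (length ℓ), given by (a , ℓ)

Interval : Set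
Interval = ℕ × ℕ

_∈I_ : ℕ → Interval → Set
k ∈I (a , ℓ) = (a ≤ k) × (k ℕ.< a + ℓ)

_∈I?_ : (k : ℕ) → (I : Interval) → Dec (k ∈I I)
k ∈I? (a , ℓ) = (a ℕ.≤? k) ×-dec (k ℕ.<? a + ℓ)

len : Interval → ℕ
len (a , ℓ) = ℓ

-- |S(t,v) ∩ I|: the labels in S(t,v) are pairwise distinct (t is a
-- bijection), so this is the number of u ≠ v with t({u,v}) ∈ I.
countSI : ∀ {n} → Labeling n → Fin n → Interval → ℕ
countSI {n} t v I =
  ΣFin n (λ u → if ⌊ (v Fin.≟ u) ⌋ then 0 else (if ⌊ lab t u v ∈I? I ⌋ then 1 else 0))

IsDecomposition : (n m : ℕ) → (Fin m → Interval) → Set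
IsDecomposition n m I =
  (∀ k → (1 ≤ k × k ≤ numEdges n) → ∃ λ i → k ∈I I i)
  × (∀ i k → k ∈I I i → 1 ≤ k × k ≤ numEdges n)
  × (∀ i j k → k ∈I I i → k ∈I I j → i ≡ j)

BigOn : (ℕ → ℕ) → Set
BigOn α = ∃ λ C → ∃ λ N → ∀ n → N ≤ n → α n ≤ C * n

LittleOn : (ℕ → ℕ) → Set
LittleOn p = ∀ k → ℕ.NonZero k → ∃ λ N → ∀ n → N ≤ n → k * p n ≤ n

TendsToInfinity : (ℕ → ℕ) → Set
TendsToInfinity p = ∀ M → ∃ λ N → ∀ n → N ≤ n → M ≤ p n

Admissible : (ℕ → ℕ) → Set
Admissible p = LittleOn p × TendsToInfinity p

ℕtoℚ : ℕ → ℚ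
ℕtoℚ k = + k ℚ./ 1

-- R(p,t,n) is the maximum of |s(θt,u) − s(θt,v)|
-- over the (finite, nonempty) set of p-swaps θ and pairs u ≠ v, so
-- R ≥ x iff some p-swap and some u ≠ v attain a difference ≥ x.
-- The ratio is only defined when 2pn > 0, which we require.
RatioAtLeast : ∀ {n} → ℕ → Labeling n → ℚ → Set
RatioAtLeast {n} p t c =
  (0 ℕ.< 2 * p * n) ×
  (∃ λ t' → IsPSwapOf p t t' × ∃ λ u → ∃ λ v → (u ≢ v) ×
     (c ℚ.* ℕtoℚ (2 * p * n) ℚ.≤ ℕtoℚ ∣ s t' u - s t' v ∣))

-- r(p,t) ≥ c, where r(p,t) = limsup_{n→∞} R(p(n),t_n,n)/(2 p(n) n):
-- limsup_n a_n ≥ c  iff  for every rational ε > 0 and every N there is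
-- n ≥ N with a_n ≥ c − ε.
rAtLeast : (p : ℕ → ℕ) → (t : (n : ℕ) → Labeling n) → ℚ → Set
rAtLeast p t c =
  ∀ (ε : ℚ) → ℚ.Positive ε → ∀ N → ∃ λ n → (N ≤ n) × RatioAtLeast (p n) (t n) (c ℚ.- ε)

-- We take p* = p and prove the stronger bound r(p,t) ≥ 1.  Fix two vertices u, v, let g = p − 9 and
-- q = g + 5, and call an edge raised if it contains u but not v, lowered if it contains v but not u,
-- and kept otherwise.  Sort the edges by their label plus 2q (raised), q (kept) or 0 (lowered) and
-- relabel each edge by its position in this order.  A window of 4p consecutive labels meets at most
-- two blocks of the decomposition, and a block contains at most two labels at a vertex, so a window
-- of length 2q contains at most four raised and four lowered labels.  Hence every label moves by at
-- most q + 4 = p, so the relabeling is a p-swap, while all but five labels at u rise by at least g and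
-- all but five labels at v fall by at least g.  Therefore s(θt,u) − s(θt,v) ≥ 2gn − α − O(g), and as
-- α = O(n), p → ∞ and p = o(n), the ratio R(p,t,n)/(2pn) tends to 1.

module Submission where

open import Data.Nat as ℕ using (ℕ; zero; suc; _+_; _*_; _∸_; _≤_; _<_; _⊓_; _⊔_; z≤n; s≤s; _≤?_; _<?_; ∣_-_∣; NonZero)
open import Data.Nat.Properties
open import Data.Nat.Tactic.RingSolver using (solve-∀)
open import Data.Fin as Fin using (Fin; toℕ)
open import Data.Fin.Properties using (toℕ<n; toℕ-inject₁; toℕ-fromℕ; toℕ-injective; toℕ-fromℕ<; any?; punchOut-injective; injective⇒≤)
import Data.Fin.Properties as Finₚ
open import Data.Product using (Σ; ∃; _×_; _,_; proj₁; proj₂)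
open import Data.Sum using (_⊎_; inj₁; inj₂)
open import Data.Empty using (⊥; ⊥-elim)
open import Relation.Nullary using (¬_; Dec; yes; no; contradiction)
open import Relation.Nullary.Decidable using (⌊_⌋; _×-dec_; _⊎-dec_; ¬?)
open import Relation.Binary using (tri<; tri≈; tri>)
open import Function.Bundles using (_⤖_; Bijection; mk⤖)
open import Function.Construct.Composition using (_⤖-∘_)
open import Relation.Binary.PropositionalEquality
import Data.Bool
import Data.Integer as ℤ
import Data.Integer.Properties as ℤP
open import Data.Rational as ℚ using (ℚ; mkℚ; 1ℚ; _/_)
import Data.Rational
import Data.Rational.Properties as ℚP
open import Data.Rational.Unnormalised as ℚᵘ using (mkℚᵘ; *≤*)
import Data.Rational.Unnormalised.Properties as ℚᵘP
open import Defs

χ : {P : Set} → Dec P → ℕ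
χ (yes _) = 1
χ (no _)  = 0

χ≤1 : {P : Set} (P? : Dec P) → χ P? ≤ 1
χ≤1 (yes _) = s≤s z≤n
χ≤1 (no _)  = z≤n

χ-yes : {P : Set} (P? : Dec P) → P → χ P? ≡ 1
χ-yes (yes _) _ = refl
χ-yes (no ¬p) p = ⊥-elim (¬p p)

χ-no : {P : Set} (P? : Dec P) → ¬ P → χ P? ≡ 0
χ-no (yes p) ¬p = ⊥-elim (¬p p)
χ-no (no _)  _  = refl

χ-mono : {P Q : Set} (P? : Dec P) (Q? : Dec Q) → (P → Q) → χ P? ≤ χ Q?
χ-mono (yes p) (yes _) _   = ≤-refl
χ-mono (yes p) (no ¬q) p⇒q = ⊥-elim (¬q (p⇒q p))
χ-mono (no _)  _       _   = z≤n

χ-≤-⊎ : {P Q R : Set} (P? : Dec P) (Q? : Dec Q) (R? : Dec R) → (P → Q ⊎ R) → χ P? ≤ χ Q? + χ R?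
χ-≤-⊎ (no _)  _       _       _     = z≤n
χ-≤-⊎ (yes _) (yes _) _       _     = s≤s z≤n
χ-≤-⊎ (yes _) (no _)  (yes _) _     = s≤s z≤n
χ-≤-⊎ (yes p) (no ¬q) (no ¬r) split with split p
... | inj₁ q = ⊥-elim (¬q q)
... | inj₂ r = ⊥-elim (¬r r)

χ-disjoint-⊎-≤ : {P Q R : Set} (P? : Dec P) (Q? : Dec Q) (R? : Dec R) →
                 (Q → P) → (R → P) → (Q → R → ⊥) → χ Q? + χ R? ≤ χ P?
χ-disjoint-⊎-≤ P? (yes q) (yes r) _   _   disj = ⊥-elim (disj q r)
χ-disjoint-⊎-≤ P? (yes q) (no _)  q⇒p _   _    = ≤-reflexive (sym (χ-yes P? (q⇒p q)))
χ-disjoint-⊎-≤ P? (no _)  (yes r) _   r⇒p _    = ≤-reflexive (sym (χ-yes P? (r⇒p r)))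
χ-disjoint-⊎-≤ P? (no _)  (no _)  _   _   _    = z≤n

if-χ : {P : Set} (P? : Dec P) → (Data.Bool.if ⌊ P? ⌋ then 1 else 0) ≡ χ P?
if-χ (yes _) = refl
if-χ (no _)  = refl

ΣFin-cong : ∀ n {f g : Fin n → ℕ} → (∀ i → f i ≡ g i) → ΣFin n f ≡ ΣFin n g
ΣFin-cong zero    f≗g = refl
ΣFin-cong (suc n) f≗g = cong₂ _+_ (f≗g Fin.zero) (ΣFin-cong n (λ i → f≗g (Fin.suc i)))

ΣFin-mono-≤ : ∀ n {f g : Fin n → ℕ} → (∀ i → f i ≤ g i) → ΣFin n f ≤ ΣFin n g
ΣFin-mono-≤ zero    f≤g = z≤n
ΣFin-mono-≤ (suc n) f≤g = +-mono-≤ (f≤g Fin.zero) (ΣFin-mono-≤ n (λ i → f≤g (Fin.suc i)))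

ΣFin-mono-< : ∀ n {f g : Fin n → ℕ} (k : Fin n) → (∀ i → f i ≤ g i) → f k < g k → ΣFin n f < ΣFin n g
ΣFin-mono-< (suc n) Fin.zero    f≤g fk<gk = +-mono-<-≤ fk<gk (ΣFin-mono-≤ n (λ i → f≤g (Fin.suc i)))
ΣFin-mono-< (suc n) (Fin.suc k) f≤g fk<gk = +-mono-≤-< (f≤g Fin.zero) (ΣFin-mono-< n k (λ i → f≤g (Fin.suc i)) fk<gk)

ΣFin-const : ∀ n c → ΣFin n (λ _ → c) ≡ n * c
ΣFin-const zero    c = refl
ΣFin-const (suc n) c = cong (c +_) (ΣFin-const n c)

ΣFin-zero : ∀ n {f : Fin n → ℕ} → (∀ i → f i ≡ 0) → ΣFin n f ≡ 0
ΣFin-zero n f≗0 = trans (ΣFin-cong n f≗0) (trans (ΣFin-const n 0) (*-zeroʳ n))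

ΣFin-distrib-+ : ∀ n (f g : Fin n → ℕ) → ΣFin n (λ i → f i + g i) ≡ ΣFin n f + ΣFin n g
ΣFin-distrib-+ zero    f g = refl
ΣFin-distrib-+ (suc n) f g =
  trans (cong (f Fin.zero + g Fin.zero +_) (ΣFin-distrib-+ n (λ i → f (Fin.suc i)) (λ i → g (Fin.suc i))))
        (shuffle (f Fin.zero) (g Fin.zero) _ _)
  where
  shuffle : ∀ a b c d → a + b + (c + d) ≡ a + c + (b + d)
  shuffle = solve-∀

*-distribˡ-ΣFin : ∀ n c (f : Fin n → ℕ) → ΣFin n (λ i → c * f i) ≡ c * ΣFin n f
*-distribˡ-ΣFin zero    c f = sym (*-zeroʳ c)
*-distribˡ-ΣFin (suc n) c f =
  trans (cong (c * f Fin.zero +_) (*-distribˡ-ΣFin n c (λ i → f (Fin.suc i)))) (sym (*-distribˡ-+ c _ _))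

ΣFin-comm : ∀ m n (F : Fin m → Fin n → ℕ) → ΣFin m (λ i → ΣFin n (F i)) ≡ ΣFin n (λ j → ΣFin m (λ i → F i j))
ΣFin-comm zero    n F = sym (ΣFin-zero n (λ _ → refl))
ΣFin-comm (suc m) n F =
  trans (cong (ΣFin n (F Fin.zero) +_) (ΣFin-comm m n (λ i → F (Fin.suc i))))
        (sym (ΣFin-distrib-+ n (F Fin.zero) _))

ΣFin-≤-+ : ∀ n {f g h : Fin n → ℕ} → (∀ i → f i ≤ g i + h i) → ΣFin n f ≤ ΣFin n g + ΣFin n h
ΣFin-≤-+ n {g = g} {h} f≤g+h = ≤-trans (ΣFin-mono-≤ n f≤g+h) (≤-reflexive (ΣFin-distrib-+ n g h))

ΣFin-χ-mono : ∀ n {P Q : Fin n → Set} (P? : ∀ i → Dec (P i)) (Q? : ∀ i → Dec (Q i)) →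
              (∀ i → P i → Q i) → ΣFin n (λ i → χ (P? i)) ≤ ΣFin n (λ i → χ (Q? i))
ΣFin-χ-mono n P? Q? P⇒Q = ΣFin-mono-≤ n (λ i → χ-mono (P? i) (Q? i) (P⇒Q i))

ΣFin-χ-⊎ : ∀ n {P Q R : Fin n → Set} (P? : ∀ i → Dec (P i)) (Q? : ∀ i → Dec (Q i)) (R? : ∀ i → Dec (R i)) →
           (∀ i → P i → Q i ⊎ R i) → ΣFin n (λ i → χ (P? i)) ≤ ΣFin n (λ i → χ (Q? i)) + ΣFin n (λ i → χ (R? i))
ΣFin-χ-⊎ n P? Q? R? split = ΣFin-≤-+ n (λ i → χ-≤-⊎ (P? i) (Q? i) (R? i) (split i))

ΣFin-χ-disjoint : ∀ n {P Q R : Fin n → Set} (P? : ∀ i → Dec (P i)) (Q? : ∀ i → Dec (Q i)) (R? : ∀ i → Dec (R i)) →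
                  (∀ i → Q i → P i) → (∀ i → R i → P i) → (∀ i → Q i → R i → ⊥) →
                  ΣFin n (λ i → χ (Q? i)) + ΣFin n (λ i → χ (R? i)) ≤ ΣFin n (λ i → χ (P? i))
ΣFin-χ-disjoint n P? Q? R? Q⇒P R⇒P disjoint = ≤-trans (≤-reflexive (sym (ΣFin-distrib-+ n _ _)))
  (ΣFin-mono-≤ n (λ i → χ-disjoint-⊎-≤ (P? i) (Q? i) (R? i) (Q⇒P i) (R⇒P i) (disjoint i)))

term-≤-ΣFin : ∀ n (f : Fin n → ℕ) i → f i ≤ ΣFin n f
term-≤-ΣFin (suc n) f Fin.zero    = m≤m+n _ _
term-≤-ΣFin (suc n) f (Fin.suc i) = ≤-trans (term-≤-ΣFin n (λ j → f (Fin.suc j)) i) (m≤n+m _ _)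

ΣFin-χ-≤1 : ∀ n {R : Fin n → Set} (R? : ∀ i → Dec (R i)) →
                (∀ i j → R i → R j → i ≡ j) → ΣFin n (λ i → χ (R? i)) ≤ 1
ΣFin-χ-≤1 zero    R? unique = z≤n
ΣFin-χ-≤1 (suc n) R? unique with R? Fin.zero
... | yes r₀ = s≤s (≤-reflexive (ΣFin-zero n (λ i → χ-no (R? (Fin.suc i)) (λ r → 0≢suc (unique _ _ r₀ r)))))
  where
  0≢suc : ∀ {i : Fin n} → Fin.zero ≢ Fin.suc i
  0≢suc ()
... | no _ = ΣFin-χ-≤1 n (λ i → R? (Fin.suc i)) (λ i j r r′ → Finₚ.suc-injective (unique _ _ r r′))

ΣFin-χ-unique : ∀ n {R : Fin n → Set} {Q : Set} (R? : ∀ i → Dec (R i)) (Q? : Dec Q) →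
                (∀ i j → R i → R j → i ≡ j) → (∀ i → R i → Q) → ΣFin n (λ i → χ (R? i)) ≤ χ Q?
ΣFin-χ-unique n R? (yes _) unique _   = ΣFin-χ-≤1 n R? unique
ΣFin-χ-unique n R? (no ¬q) _      R⇒Q = ≤-reflexive (ΣFin-zero n (λ i → χ-no (R? i) (λ r → ¬q (R⇒Q i r))))

ΣFin-weighted-gain : ∀ n {G : Fin n → Set} (G? : ∀ w → Dec (G w)) (x : Fin n) (f h : Fin n → ℕ) g c →
                     (∀ w → f w ≤ h w + c * χ (w Fin.≟ x)) → (∀ w → G w → f w + g ≤ h w) →
                     ΣFin n f + g * ΣFin n (λ w → χ (G? w)) ≤ ΣFin n h + c
ΣFin-weighted-gain n G? x f h g c f≤h+c gain = begin
  ΣFin n f + g * ΣFin n (λ w → χ (G? w))                 ≡⟨ cong (ΣFin n f +_) (sym (*-distribˡ-ΣFin n g _)) ⟩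
  ΣFin n f + ΣFin n (λ w → g * χ (G? w))                 ≡⟨ sym (ΣFin-distrib-+ n f _) ⟩
  ΣFin n (λ w → f w + g * χ (G? w))                      ≤⟨ ΣFin-mono-≤ n pointwise ⟩
  ΣFin n (λ w → h w + c * χ (w Fin.≟ x))                 ≡⟨ ΣFin-distrib-+ n h _ ⟩
  ΣFin n h + ΣFin n (λ w → c * χ (w Fin.≟ x))            ≡⟨ cong (ΣFin n h +_) (*-distribˡ-ΣFin n c _) ⟩
  ΣFin n h + c * ΣFin n (λ w → χ (w Fin.≟ x))            ≤⟨ +-monoʳ-≤ (ΣFin n h) (*-monoʳ-≤ c at-most-x) ⟩
  ΣFin n h + c * 1                                       ≡⟨ cong (ΣFin n h +_) (*-identityʳ c) ⟩
  ΣFin n h + c                                           ∎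
  where
  open ≤-Reasoning
  at-most-x : ΣFin n (λ w → χ (w Fin.≟ x)) ≤ 1
  at-most-x = ΣFin-χ-≤1 n (Fin._≟ x) (λ i j i≡x j≡x → trans i≡x (sym j≡x))
  pointwise : ∀ w → f w + g * χ (G? w) ≤ h w + c * χ (w Fin.≟ x)
  pointwise w with G? w
  ... | yes Gw = ≤-trans (subst (λ z → f w + z ≤ h w) (sym (*-identityʳ g)) (gain w Gw)) (m≤m+n _ _)
  ... | no _   = subst (_≤ _) (sym (trans (cong (f w +_) (*-zeroʳ g)) (+-identityʳ (f w)))) (f≤h+c w)

ΣFin-snoc : ∀ n (f : Fin (suc n) → ℕ) → ΣFin (suc n) f ≡ ΣFin n (λ i → f (Fin.inject₁ i)) + f (Fin.fromℕ n)
ΣFin-snoc zero    f = +-comm (f Fin.zero) 0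
ΣFin-snoc (suc n) f =
  trans (cong (f Fin.zero +_) (ΣFin-snoc n (λ i → f (Fin.suc i)))) (sym (+-assoc (f Fin.zero) _ _))

-- Counting integers in a window

m<n+o⇒1+m∸o≤n : ∀ m n o → m < n + o → suc m ∸ o ≤ n
m<n+o⇒1+m∸o≤n m n o m<n+o = m≤n+o⇒m∸n≤o (suc m) o (subst (suc m ≤_) (+-comm n o) m<n+o)

m≤1+m∸n+n : ∀ m n → m ≤ suc m ∸ n + n
m≤1+m∸n+n m n = ≤-trans (n≤1+n m) (subst (suc m ≤_) (+-comm n _) (m≤n+m∸n (suc m) n))

∣m-n∣≤o : ∀ {m n o} → m ≤ n + o → n ≤ m + o → ∣ m - n ∣ ≤ o
∣m-n∣≤o {m} {n} m≤n+o n≤m+o with ∣m-n∣≡[m∸n]∨[n∸m] m n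
... | inj₁ eq = subst (_≤ _) (sym eq) (m≤n+o⇒m∸n≤o m n m≤n+o)
... | inj₂ eq = subst (_≤ _) (sym eq) (m≤n+o⇒m∸n≤o n m n≤m+o)

InWindow : ℕ → ℕ → ℕ → Set
InWindow lo hi x = lo ≤ x × x < hi

inWindow? : ∀ lo hi x → Dec (InWindow lo hi x)
inWindow? lo hi x = (lo ≤? x) ×-dec (x <? hi)

#window : ℕ → ℕ → ℕ → ℕ
#window E lo hi = ΣFin E (λ k → χ (inWindow? lo hi (toℕ k)))

#window-suc : ∀ E lo hi → #window (suc E) lo hi ≡ #window E lo hi + χ (inWindow? lo hi E)
#window-suc E lo hi = trans (ΣFin-snoc E (λ k → χ (inWindow? lo hi (toℕ k))))
  (cong₂ _+_ (ΣFin-cong E (λ i → cong (λ x → χ (inWindow? lo hi x)) (toℕ-inject₁ i)))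
             (cong (λ x → χ (inWindow? lo hi x)) (toℕ-fromℕ E)))

#window≡ : ∀ E lo hi → #window E lo hi ≡ E ⊓ hi ∸ lo
#window≡ zero    lo hi = sym (0∸n≡0 lo)
#window≡ (suc E) lo hi = trans (#window-suc E lo hi) (trans (cong (_+ χ (inWindow? lo hi E)) (#window≡ E lo hi)) step)
  where
  step : E ⊓ hi ∸ lo + χ (inWindow? lo hi E) ≡ suc E ⊓ hi ∸ lo
  step with lo ≤? E | E <? hi
  ... | yes lo≤E | yes E<hi = begin
    E ⊓ hi ∸ lo + 1   ≡⟨ cong (λ x → x ∸ lo + 1) (m≤n⇒m⊓n≡m (<⇒≤ E<hi)) ⟩
    E ∸ lo + 1        ≡⟨ +-comm (E ∸ lo) 1 ⟩
    suc (E ∸ lo)      ≡⟨ sym (+-∸-assoc 1 lo≤E) ⟩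
    suc E ∸ lo        ≡⟨ cong (_∸ lo) (sym (m≤n⇒m⊓n≡m E<hi)) ⟩
    suc E ⊓ hi ∸ lo   ∎
    where open ≡-Reasoning
  ... | no lo≰E | _ = trans (+-identityʳ _)
    (trans (m≤n⇒m∸n≡0 (≤-trans (m⊓n≤m E hi) (<⇒≤ E<lo)))
           (sym (m≤n⇒m∸n≡0 (≤-trans (m⊓n≤m (suc E) hi) E<lo))))
    where E<lo = ≰⇒> lo≰E
  ... | yes _ | no E≮hi = trans (+-identityʳ _)
    (cong (_∸ lo) (trans (m≥n⇒m⊓n≡n hi≤E) (sym (m≥n⇒m⊓n≡n (≤-trans hi≤E (n≤1+n E))))))
    where hi≤E = ≮⇒≥ E≮hi

#window-≤ : ∀ E lo hi d → hi ≤ lo + d → #window E lo hi ≤ d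
#window-≤ E lo hi d hi≤lo+d =
  ≤-trans (≤-reflexive (#window≡ E lo hi)) (m≤n+o⇒m∸n≤o (E ⊓ hi) lo (≤-trans (m⊓n≤n E hi) hi≤lo+d))

#window-exact : ∀ E lo hi → lo ≤ hi → hi ≤ E → #window E lo hi + lo ≡ hi
#window-exact E lo hi lo≤hi hi≤E =
  trans (cong (_+ lo) (trans (#window≡ E lo hi) (cong (_∸ lo) (m≥n⇒m⊓n≡n hi≤E)))) (m∸n+n≡m lo≤hi)

#window-below : ∀ {E} (k : Fin E) → #window E 0 (toℕ k) ≡ toℕ k
#window-below {E} k = trans (sym (+-identityʳ _)) (#window-exact E 0 (toℕ k) z≤n (<⇒≤ (toℕ<n k)))

-- Ranking by a key

injective⇒surjective : ∀ {E} (f : Fin E → Fin E) → (∀ {a b} → f a ≡ f b → a ≡ b) → ∀ y → ∃ λ x → f x ≡ y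
injective⇒surjective {suc E} f f-inj y with any? (λ x → f x Fin.≟ y)
... | yes hit = hit
... | no miss = ⊥-elim (<-irrefl refl (injective⇒≤ {f = avoid} avoid-inj))
  where
  y≢f : ∀ x → y ≢ f x
  y≢f x y≡fx = miss (x , sym y≡fx)
  avoid : Fin (suc E) → Fin E
  avoid x = Fin.punchOut (y≢f x)
  avoid-inj : ∀ {a b} → avoid a ≡ avoid b → a ≡ b
  avoid-inj eq = f-inj (punchOut-injective (y≢f _) (y≢f _) eq)

injection⇒⤖ : ∀ {E} (r : Fin E → ℕ) (r< : ∀ k → r k < E) → (∀ {a b} → r a ≡ r b → a ≡ b) →
              Σ (Fin E ⤖ Fin E) λ σ → ∀ k → toℕ (Bijection.to σ k) ≡ r k
injection⇒⤖ {E} r r< r-inj = mk⤖ (σ-inj , surj) , λ k → toℕ-fromℕ< (r< k)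
  where
  σ : Fin E → Fin E
  σ k = Fin.fromℕ< (r< k)
  σ-inj : ∀ {a b} → σ a ≡ σ b → a ≡ b
  σ-inj {a} {b} eq = r-inj (trans (sym (toℕ-fromℕ< (r< a))) (trans (cong toℕ eq) (toℕ-fromℕ< (r< b))))
  surj : ∀ y → ∃ λ x → ∀ {z} → z ≡ x → σ z ≡ y
  surj y with injective⇒surjective σ σ-inj y
  ... | x , σx≡y = x , λ { refl → σx≡y }

module Ranking {E : ℕ} (key : Fin E → ℕ) where

  _≺_ : Fin E → Fin E → Set
  j ≺ k = key j < key k ⊎ (key j ≡ key k × toℕ j < toℕ k)

  _≺?_ : ∀ j k → Dec (j ≺ k)
  j ≺? k = (key j <? key k) ⊎-dec ((key j ℕ.≟ key k) ×-dec (toℕ j <? toℕ k))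

  ≺⇒key≤ : ∀ {j k} → j ≺ k → key j ≤ key k
  ≺⇒key≤ (inj₁ lt)     = <⇒≤ lt
  ≺⇒key≤ (inj₂ (eq , _)) = ≤-reflexive eq

  ≺-irrefl : ∀ {k} → ¬ k ≺ k
  ≺-irrefl (inj₁ lt)       = <-irrefl refl lt
  ≺-irrefl (inj₂ (_ , lt)) = <-irrefl refl lt

  ≺-trans : ∀ {a b c} → a ≺ b → b ≺ c → a ≺ c
  ≺-trans (inj₁ lt) (inj₁ lt′)             = inj₁ (<-trans lt lt′)
  ≺-trans (inj₁ lt) (inj₂ (eq , _))        = inj₁ (<-≤-trans lt (≤-reflexive eq))
  ≺-trans (inj₂ (eq , _)) (inj₁ lt)        = inj₁ (≤-<-trans (≤-reflexive eq) lt)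
  ≺-trans (inj₂ (eq , lt)) (inj₂ (eq′ , lt′)) = inj₂ (trans eq eq′ , <-trans lt lt′)

  ≺-total : ∀ {j k} → j ≢ k → j ≺ k ⊎ k ≺ j
  ≺-total {j} {k} j≢k with <-cmp (key j) (key k) | <-cmp (toℕ j) (toℕ k)
  ... | tri< lt _ _ | _            = inj₁ (inj₁ lt)
  ... | tri> _ _ gt | _            = inj₂ (inj₁ gt)
  ... | tri≈ _ eq _ | tri< lt _ _  = inj₁ (inj₂ (eq , lt))
  ... | tri≈ _ _ _  | tri≈ _ eq′ _ = ⊥-elim (j≢k (toℕ-injective eq′))
  ... | tri≈ _ eq _ | tri> _ _ gt  = inj₂ (inj₂ (sym eq , gt))

  ¬≺⇒key> : ∀ {j k} → ¬ j ≺ k → toℕ j < toℕ k → key k < key j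
  ¬≺⇒key> {j} {k} j⊀k j<k with <-cmp (key k) (key j)
  ... | tri< lt _ _ = lt
  ... | tri≈ _ eq _ = ⊥-elim (j⊀k (inj₂ (sym eq , j<k)))
  ... | tri> _ _ gt = ⊥-elim (j⊀k (inj₁ gt))

  rank : Fin E → ℕ
  rank k = ΣFin E (λ j → χ (j ≺? k))

  rank<E : ∀ k → rank k < E
  rank<E k = subst (rank k <_) (trans (ΣFin-const E 1) (*-identityʳ E))
    (ΣFin-mono-< E k (λ j → χ≤1 (j ≺? k)) (subst (_< 1) (sym (χ-no (k ≺? k) ≺-irrefl)) (s≤s z≤n)))

  rank-mono : ∀ {j k} → j ≺ k → rank j < rank k
  rank-mono {j} {k} j≺k = ΣFin-mono-< E j (λ i → χ-mono (i ≺? j) (i ≺? k) (λ i≺j → ≺-trans i≺j j≺k))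
    (subst₂ _<_ (sym (χ-no (j ≺? j) ≺-irrefl)) (sym (χ-yes (j ≺? k) j≺k)) (s≤s z≤n))

  rank-injective : ∀ {j k} → rank j ≡ rank k → j ≡ k
  rank-injective {j} {k} eq with j Fin.≟ k
  ... | yes j≡k = j≡k
  ... | no j≢k with ≺-total j≢k
  ...   | inj₁ j≺k = ⊥-elim (<-irrefl eq (rank-mono j≺k))
  ...   | inj₂ k≺j = ⊥-elim (<-irrefl (sym eq) (rank-mono k≺j))

  #overtaking : Fin E → ℕ
  #overtaking k = ΣFin E (λ j → χ ((j ≺? k) ×-dec (toℕ k <? toℕ j)))

  #overtaken : Fin E → ℕ
  #overtaken k = ΣFin E (λ j → χ (¬? (j ≺? k) ×-dec (toℕ j <? toℕ k)))

  rank≤index+#overtaking : ∀ k → rank k ≤ toℕ k + #overtaking k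
  rank≤index+#overtaking k = subst (λ x → rank k ≤ x + #overtaking k) (#window-below k)
    (ΣFin-χ-⊎ E (_≺? k) (λ j → inWindow? 0 (toℕ k) (toℕ j)) (λ j → (j ≺? k) ×-dec (toℕ k <? toℕ j)) cases)
    where
    cases : ∀ j → j ≺ k → InWindow 0 (toℕ k) (toℕ j) ⊎ (j ≺ k × toℕ k < toℕ j)
    cases j j≺k with <-cmp (toℕ j) (toℕ k)
    ... | tri< lt _ _ = inj₁ (z≤n , lt)
    ... | tri≈ _ eq _ = ⊥-elim (≺-irrefl (subst (_≺ k) (toℕ-injective eq) j≺k))
    ... | tri> _ _ gt = inj₂ (j≺k , gt)

  index≤rank+#overtaken : ∀ k → toℕ k ≤ rank k + #overtaken k
  index≤rank+#overtaken k = subst (_≤ rank k + #overtaken k) (#window-below k)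
    (ΣFin-χ-⊎ E (λ j → inWindow? 0 (toℕ k) (toℕ j)) (_≺? k) (λ j → ¬? (j ≺? k) ×-dec (toℕ j <? toℕ k)) cases)
    where
    cases : ∀ j → InWindow 0 (toℕ k) (toℕ j) → j ≺ k ⊎ (¬ j ≺ k × toℕ j < toℕ k)
    cases j (_ , j<k) with j ≺? k
    ... | yes j≺k = inj₁ j≺k
    ... | no j⊀k  = inj₂ (j⊀k , j<k)

  rankPermutation : Σ (Fin E ⤖ Fin E) λ σ → ∀ k → toℕ (Bijection.to σ k) ≡ rank k
  rankPermutation = injection⇒⤖ rank rank<E rank-injective

-- Sorting with raised, kept and lowered elements

data Role : Set where
  raised kept lowered : Role

_≟ʳ_ : (c c′ : Role) → Dec (c ≡ c′)
raised  ≟ʳ raised  = yes refl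
kept    ≟ʳ kept    = yes refl
lowered ≟ʳ lowered = yes refl
raised  ≟ʳ kept    = no λ ()
raised  ≟ʳ lowered = no λ ()
kept    ≟ʳ raised  = no λ ()
kept    ≟ʳ lowered = no λ ()
lowered ≟ʳ raised  = no λ ()
lowered ≟ʳ kept    = no λ ()

roleOf : {A B : Set} → Dec A → Dec B → Role
roleOf (yes _) (no _)  = raised
roleOf (no _)  (yes _) = lowered
roleOf _       _       = kept

roleOf-raised⇒ : {A B : Set} (A? : Dec A) (B? : Dec B) → roleOf A? B? ≡ raised → A
roleOf-raised⇒ (yes a) (no _)  _ = a
roleOf-raised⇒ (yes _) (yes _) ()
roleOf-raised⇒ (no _)  (yes _) ()
roleOf-raised⇒ (no _)  (no _)  ()

roleOf-lowered⇒ : {A B : Set} (A? : Dec A) (B? : Dec B) → roleOf A? B? ≡ lowered → B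
roleOf-lowered⇒ (no _)  (yes b) _ = b
roleOf-lowered⇒ (yes _) (yes _) ()
roleOf-lowered⇒ (yes _) (no _)  ()
roleOf-lowered⇒ (no _)  (no _)  ()

roleOf-raised : {A B : Set} (A? : Dec A) (B? : Dec B) → A → ¬ B → roleOf A? B? ≡ raised
roleOf-raised (yes _) (no _)  _ _  = refl
roleOf-raised (yes _) (yes b) _ ¬b = ⊥-elim (¬b b)
roleOf-raised (no ¬a) _       a _  = ⊥-elim (¬a a)

roleOf-lowered : {A B : Set} (A? : Dec A) (B? : Dec B) → ¬ A → B → roleOf A? B? ≡ lowered
roleOf-lowered (no _)  (yes _) _  _ = refl
roleOf-lowered (yes a) _       ¬a _ = ⊥-elim (¬a a)
roleOf-lowered (no _)  (no ¬b) _  b = ⊥-elim (¬b b)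

roleOf-kept : {A B : Set} (A? : Dec A) (B? : Dec B) → A → B → roleOf A? B? ≡ kept
roleOf-kept (yes _) (yes _) _ _ = refl
roleOf-kept (no ¬a) _       a _ = ⊥-elim (¬a a)
roleOf-kept (yes _) (no ¬b) _ b = ⊥-elim (¬b b)

module RoleSort (E q : ℕ) (role : Fin E → Role) where

  offset : Role → ℕ
  offset raised  = q + q
  offset kept    = q
  offset lowered = 0

  key : Fin E → ℕ
  key k = toℕ k + offset (role k)

  open Ranking key public

  key-role : ∀ {k c} → role k ≡ c → key k ≡ toℕ k + offset c
  key-role rk = cong (λ c → _ + offset c) rk

  offset≤q+q : ∀ c → offset c ≤ q + q
  offset≤q+q raised  = ≤-refl
  offset≤q+q kept    = m≤n+m q q
  offset≤q+q lowered = z≤n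

  offset≤q : ∀ {c} → c ≢ raised → offset c ≤ q
  offset≤q {raised}  c≢raised = ⊥-elim (c≢raised refl)
  offset≤q {kept}    _        = ≤-refl
  offset≤q {lowered} _        = z≤n

  q≤offset : ∀ {c} → c ≢ lowered → q ≤ offset c
  q≤offset {raised}  _         = m≤m+n q q
  q≤offset {kept}    _         = ≤-refl
  q≤offset {lowered} c≢lowered = ⊥-elim (c≢lowered refl)

  raised-above : ∀ {j k} → role k ≡ raised → toℕ j < toℕ k → j ≺ k
  raised-above {j} {k} rk j<k = inj₁ (subst (key j <_) (sym (key-role rk))
    (≤-<-trans (+-monoʳ-≤ (toℕ j) (offset≤q+q (role j))) (+-monoˡ-< (q + q) j<k)))

  lowered-below : ∀ {j k} → role k ≡ lowered → j ≺ k → toℕ j < toℕ k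
  lowered-below {j} {k} rk j≺k with <-cmp (toℕ j) (toℕ k)
  ... | tri< lt _ _ = lt
  ... | tri≈ _ eq _ = ⊥-elim (≺-irrefl (subst (_≺ k) (toℕ-injective eq) j≺k))
  ... | tri> _ _ gt = ⊥-elim (<⇒≱ gt (≤-trans (m≤m+n (toℕ j) _)
                        (subst (key j ≤_) (trans (key-role rk) (+-identityʳ _)) (≺⇒key≤ j≺k))))

  RoleWindow : Role → ℕ → ℕ → Fin E → Set
  RoleWindow c lo hi j = role j ≡ c × InWindow lo hi (toℕ j)

  roleWindow? : ∀ c lo hi j → Dec (RoleWindow c lo hi j)
  roleWindow? c lo hi j = (role j ≟ʳ c) ×-dec inWindow? lo hi (toℕ j)

  #role : Role → ℕ → ℕ → ℕ
  #role c lo hi = ΣFin E (λ j → χ (roleWindow? c lo hi j))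

  Sparse : Role → Set
  Sparse c = ∀ lo hi → hi ≤ lo + (q + q) → #role c lo hi ≤ 4

  Other : Role → ℕ → ℕ → Fin E → Set
  Other c lo hi j = InWindow lo hi (toℕ j) × role j ≢ c

  other? : ∀ c lo hi j → Dec (Other c lo hi j)
  other? c lo hi j = inWindow? lo hi (toℕ j) ×-dec ¬? (role j ≟ʳ c)

  #other : Role → ℕ → ℕ → ℕ
  #other c lo hi = ΣFin E (λ j → χ (other? c lo hi j))

  sparse⇒mostly-other : ∀ {c} → Sparse c → 1 ≤ q → ∀ a → a + q ≤ E → q ≤ #other c (suc a) (a + q) + 5
  sparse⇒mostly-other {c} sparse 1≤q a a+q≤E = +-cancelˡ-≤ a q (#others + 5) (begin
    a + q                            ≡⟨ sym (#window-exact E lo hi 1+a≤a+q a+q≤E) ⟩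
    #window E lo hi + lo             ≤⟨ +-monoˡ-≤ lo window≤others+4 ⟩
    #others + 4 + suc a              ≡⟨ rearrange #others a ⟩
    a + (#others + 5)                ∎)
    where
    open ≤-Reasoning
    lo = suc a
    hi = a + q
    #others = #other c lo hi
    1+a≤a+q : suc a ≤ a + q
    1+a≤a+q = subst (_≤ a + q) (+-comm a 1) (+-monoʳ-≤ a 1≤q)
    split : ∀ j → InWindow lo hi (toℕ j) → Other c lo hi j ⊎ RoleWindow c lo hi j
    split j w with role j ≟ʳ c
    ... | yes rj = inj₂ (rj , w)
    ... | no ¬rj = inj₁ (w , ¬rj)
    window≤others+4 : #window E lo hi ≤ #others + 4
    window≤others+4 = ≤-trans (ΣFin-χ-⊎ E (λ j → inWindow? lo hi (toℕ j)) (other? c lo hi) (roleWindow? c lo hi) split)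
      (+-monoʳ-≤ #others (sparse lo hi (≤-trans (+-monoʳ-≤ a (m≤m+n q q)) (n≤1+n _))))
    rearrange : ∀ x a → x + 4 + suc a ≡ a + (x + 5)
    rearrange = solve-∀

  module Displacement (raised-sparse : Sparse raised) (lowered-sparse : Sparse lowered) where

    raised-#overtaking : ∀ {k} → role k ≡ raised → #overtaking k ≤ q + 4
    raised-#overtaking {k} rk =
      ≤-trans (ΣFin-χ-⊎ E (λ j → (j ≺? k) ×-dec (toℕ k <? toℕ j)) (λ j → inWindow? lo (lo + q) (toℕ j))
                          (roleWindow? lowered lo (lo + (q + q))) place)
              (+-mono-≤ (#window-≤ E lo (lo + q) q ≤-refl) (lowered-sparse lo (lo + (q + q)) ≤-refl))
      where
      lo = suc (toℕ k)
      place : ∀ j → j ≺ k × toℕ k < toℕ j → InWindow lo (lo + q) (toℕ j) ⊎ RoleWindow lowered lo (lo + (q + q)) j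
      place j (j≺k , k<j) = classify (role j) refl
        where
        key≤ : ∀ {c} → role j ≡ c → toℕ j + offset c ≤ toℕ k + (q + q)
        key≤ rj = subst₂ _≤_ (key-role rj) (key-role rk) (≺⇒key≤ j≺k)
        classify : ∀ c → role j ≡ c → InWindow lo (lo + q) (toℕ j) ⊎ RoleWindow lowered lo (lo + (q + q)) j
        classify raised  rj = ⊥-elim (<⇒≱ k<j (+-cancelʳ-≤ (q + q) _ _ (key≤ rj)))
        classify kept    rj = inj₁ (k<j , s≤s (+-cancelʳ-≤ q _ _ (subst (toℕ j + q ≤_) (sym (+-assoc (toℕ k) q q)) (key≤ rj))))
        classify lowered rj = inj₂ (rj , k<j , s≤s (subst (_≤ _) (+-identityʳ _) (key≤ rj)))

    raised-#overtaken : ∀ {k} → role k ≡ raised → #overtaken k ≡ 0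
    raised-#overtaken {k} rk = ΣFin-zero E (λ j →
      χ-no (¬? (j ≺? k) ×-dec (toℕ j <? toℕ k)) (λ (j⊀k , j<k) → j⊀k (raised-above rk j<k)))

    lowered-#overtaking : ∀ {k} → role k ≡ lowered → #overtaking k ≡ 0
    lowered-#overtaking {k} rk = ΣFin-zero E (λ j →
      χ-no ((j ≺? k) ×-dec (toℕ k <? toℕ j)) (λ (j≺k , k<j) → <-asym k<j (lowered-below rk j≺k)))

    kept-#overtaking : ∀ {k} → role k ≡ kept → #overtaking k ≤ 4
    kept-#overtaking {k} rk =
      ≤-trans (ΣFin-χ-mono E (λ j → (j ≺? k) ×-dec (toℕ k <? toℕ j)) (roleWindow? lowered lo (lo + q)) place)
              (lowered-sparse lo (lo + q) (+-monoʳ-≤ lo (m≤m+n q q)))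
      where
      lo = suc (toℕ k)
      place : ∀ j → j ≺ k × toℕ k < toℕ j → RoleWindow lowered lo (lo + q) j
      place j (j≺k , k<j) = classify (role j) refl
        where
        key≤ : ∀ {c} → role j ≡ c → toℕ j + offset c ≤ toℕ k + q
        key≤ rj = subst₂ _≤_ (key-role rj) (key-role rk) (≺⇒key≤ j≺k)
        classify : ∀ c → role j ≡ c → RoleWindow lowered lo (lo + q) j
        classify raised  rj = ⊥-elim (<⇒≱ k<j (+-cancelʳ-≤ q _ _ (≤-trans (+-monoʳ-≤ (toℕ j) (m≤n+m q q)) (key≤ rj))))
        classify kept    rj = ⊥-elim (<⇒≱ k<j (+-cancelʳ-≤ q _ _ (key≤ rj)))
        classify lowered rj = rj , k<j , s≤s (subst (_≤ _) (+-identityʳ _) (key≤ rj))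

    kept-#overtaken : ∀ {k} → role k ≡ kept → #overtaken k ≤ 4
    kept-#overtaken {k} rk =
      ≤-trans (ΣFin-χ-mono E (λ j → ¬? (j ≺? k) ×-dec (toℕ j <? toℕ k)) (roleWindow? raised lo (toℕ k)) place)
              (raised-sparse lo (toℕ k) (≤-trans (m≤1+m∸n+n (toℕ k) q) (+-monoʳ-≤ lo (m≤n+m q q))))
      where
      lo = suc (toℕ k) ∸ q
      place : ∀ j → ¬ j ≺ k × toℕ j < toℕ k → RoleWindow raised lo (toℕ k) j
      place j (j⊀k , j<k) = classify (role j) refl
        where
        key< : ∀ {c} → role j ≡ c → toℕ k + q < toℕ j + offset c
        key< rj = subst₂ _<_ (key-role rk) (key-role rj) (¬≺⇒key> j⊀k j<k)
        classify : ∀ c → role j ≡ c → RoleWindow raised lo (toℕ k) j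
        classify raised  rj = rj , m<n+o⇒1+m∸o≤n (toℕ k) (toℕ j) q
                                     (+-cancelʳ-< q _ _ (subst (toℕ k + q <_) (sym (+-assoc (toℕ j) q q)) (key< rj))) , j<k
        classify kept    rj = ⊥-elim (<⇒≱ j<k (<⇒≤ (+-cancelʳ-< q _ _ (key< rj))))
        classify lowered rj = ⊥-elim (<⇒≱ j<k (≤-trans (m≤m+n (toℕ k) q) (<⇒≤ (subst (_ <_) (+-identityʳ _) (key< rj)))))

    lowered-#overtaken : ∀ {k} → role k ≡ lowered → #overtaken k ≤ q + 4
    lowered-#overtaken {k} rk =
      ≤-trans (ΣFin-χ-⊎ E (λ j → ¬? (j ≺? k) ×-dec (toℕ j <? toℕ k)) (λ j → inWindow? lo (toℕ k) (toℕ j))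
                          (roleWindow? raised lo₂ (toℕ k)) place)
              (+-mono-≤ (#window-≤ E lo (toℕ k) q (m≤1+m∸n+n (toℕ k) q))
                        (raised-sparse lo₂ (toℕ k) (m≤1+m∸n+n (toℕ k) (q + q))))
      where
      lo  = suc (toℕ k) ∸ q
      lo₂ = suc (toℕ k) ∸ (q + q)
      place : ∀ j → ¬ j ≺ k × toℕ j < toℕ k → InWindow lo (toℕ k) (toℕ j) ⊎ RoleWindow raised lo₂ (toℕ k) j
      place j (j⊀k , j<k) = classify (role j) refl
        where
        key< : ∀ {c} → role j ≡ c → toℕ k < toℕ j + offset c
        key< rj = subst₂ _<_ (trans (key-role rk) (+-identityʳ _)) (key-role rj) (¬≺⇒key> j⊀k j<k)
        classify : ∀ c → role j ≡ c → InWindow lo (toℕ k) (toℕ j) ⊎ RoleWindow raised lo₂ (toℕ k) j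
        classify raised  rj = inj₂ (rj , m<n+o⇒1+m∸o≤n (toℕ k) (toℕ j) (q + q) (key< rj) , j<k)
        classify kept    rj = inj₁ (m<n+o⇒1+m∸o≤n (toℕ k) (toℕ j) q (key< rj) , j<k)
        classify lowered rj = ⊥-elim (<⇒≱ j<k (<⇒≤ (subst (toℕ k <_) (+-identityʳ _) (key< rj))))

    rank≤index+ : ∀ {k d} → #overtaking k ≤ d → rank k ≤ toℕ k + d
    rank≤index+ {k} bound = ≤-trans (rank≤index+#overtaking k) (+-monoʳ-≤ (toℕ k) bound)

    index≤rank+ : ∀ {k d} → #overtaken k ≤ d → toℕ k ≤ rank k + d
    index≤rank+ {k} bound = ≤-trans (index≤rank+#overtaken k) (+-monoʳ-≤ (rank k) bound)

    raised-index≤rank : ∀ {k} → role k ≡ raised → toℕ k ≤ rank k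
    raised-index≤rank {k} rk = subst (toℕ k ≤_) (+-identityʳ (rank k)) (index≤rank+ (≤-reflexive (raised-#overtaken rk)))

    lowered-rank≤index : ∀ {k} → role k ≡ lowered → rank k ≤ toℕ k
    lowered-rank≤index {k} rk = subst (rank k ≤_) (+-identityʳ (toℕ k)) (rank≤index+ (≤-reflexive (lowered-#overtaking rk)))

    rank-displacement : ∀ k → rank k ≤ toℕ k + (q + 4) × toℕ k ≤ rank k + (q + 4)
    rank-displacement k = byRole (role k) refl
      where
      4≤q+4 : 4 ≤ q + 4
      4≤q+4 = m≤n+m 4 q
      byRole : ∀ c → role k ≡ c → rank k ≤ toℕ k + (q + 4) × toℕ k ≤ rank k + (q + 4)
      byRole raised  rk = rank≤index+ (raised-#overtaking rk) , ≤-trans (raised-index≤rank rk) (m≤m+n _ _)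
      byRole kept    rk = rank≤index+ (≤-trans (kept-#overtaking rk) 4≤q+4) ,
                          index≤rank+ (≤-trans (kept-#overtaken rk) 4≤q+4)
      byRole lowered rk = ≤-trans (lowered-rank≤index rk) (m≤m+n _ _) , index≤rank+ (lowered-#overtaken rk)

    raised-gain : ∀ {k} → role k ≡ raised → 1 ≤ q → toℕ k + q ≤ E → toℕ k + q ≤ rank k + 5
    raised-gain {k} rk 1≤q k+q≤E = begin
      toℕ k + q              ≤⟨ +-monoʳ-≤ (toℕ k) (sparse⇒mostly-other raised-sparse 1≤q (toℕ k) k+q≤E) ⟩
      toℕ k + (#others + 5)  ≡⟨ sym (+-assoc (toℕ k) #others 5) ⟩
      toℕ k + #others + 5    ≤⟨ +-monoˡ-≤ 5 below+others≤rank ⟩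
      rank k + 5             ∎
      where
      open ≤-Reasoning
      lo = suc (toℕ k)
      hi = toℕ k + q
      #others = #other raised lo hi
      other⇒≺ : ∀ j → Other raised lo hi j → j ≺ k
      other⇒≺ j ((_ , j<hi) , rj≢raised) = inj₁ (begin-strict
        toℕ j + offset (role j) ≤⟨ +-monoʳ-≤ (toℕ j) (offset≤q rj≢raised) ⟩
        toℕ j + q               <⟨ +-monoˡ-< q j<hi ⟩
        toℕ k + q + q           ≡⟨ trans (+-assoc (toℕ k) q q) (sym (key-role rk)) ⟩
        key k                   ∎)
      below+others≤rank : toℕ k + #others ≤ rank k
      below+others≤rank = subst (λ x → x + #others ≤ rank k) (#window-below k)
        (ΣFin-χ-disjoint E (_≺? k) (λ j → inWindow? 0 (toℕ k) (toℕ j)) (other? raised lo hi)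
           (λ j (_ , j<k) → raised-above rk j<k) other⇒≺ (λ j (_ , j<k) ((k<j , _) , _) → <-asym j<k k<j))

    lowered-gain : ∀ {k} → role k ≡ lowered → 1 ≤ q → q ≤ toℕ k → rank k + q ≤ toℕ k + 5
    lowered-gain {k} rk 1≤q q≤k = begin
      rank k + q              ≤⟨ +-monoʳ-≤ (rank k) mostly-other ⟩
      rank k + (#others + 5)  ≡⟨ sym (+-assoc (rank k) #others 5) ⟩
      rank k + #others + 5    ≤⟨ +-monoˡ-≤ 5 rank+others≤below ⟩
      toℕ k + 5               ∎
      where
      open ≤-Reasoning
      a = toℕ k ∸ q
      a+q≡k : a + q ≡ toℕ k
      a+q≡k = m∸n+n≡m q≤k
      #others = #other lowered (suc a) (toℕ k)
      mostly-other : q ≤ #others + 5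
      mostly-other = subst (λ hi → q ≤ #other lowered (suc a) hi + 5) a+q≡k
        (sparse⇒mostly-other lowered-sparse 1≤q a (subst (_≤ E) (sym a+q≡k) (<⇒≤ (toℕ<n k))))
      above-key : ∀ j → Other lowered (suc a) (toℕ k) j → key k < key j
      above-key j ((a<j , _) , rj≢lowered) = begin-strict
        key k                    ≡⟨ trans (key-role rk) (trans (+-identityʳ (toℕ k)) (sym a+q≡k)) ⟩
        a + q                    <⟨ +-monoˡ-< q a<j ⟩
        toℕ j + q                ≤⟨ +-monoʳ-≤ (toℕ j) (q≤offset rj≢lowered) ⟩
        key j                    ∎
      rank+others≤below : rank k + #others ≤ toℕ k
      rank+others≤below = subst (rank k + #others ≤_) (#window-below k)
        (ΣFin-χ-disjoint E (λ j → inWindow? 0 (toℕ k) (toℕ j)) (_≺? k) (other? lowered (suc a) (toℕ k))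
           (λ j j≺k → z≤n , lowered-below rk j≺k) (λ j ((_ , j<k) , _) → z≤n , j<k)
           (λ j j≺k other → <⇒≱ (above-key j other) (≺⇒key≤ j≺k)))

-- Edges and labels of K_n

_∈ₑ_ : ∀ {n} → Fin n → Edge n → Set
x ∈ₑ (i , j , _) = x ≡ i ⊎ x ≡ j

_∈ₑ?_ : ∀ {n} (x : Fin n) (e : Edge n) → Dec (x ∈ₑ e)
x ∈ₑ? (i , j , _) = (x Fin.≟ i) ⊎-dec (x Fin.≟ j)

edge-≡ : ∀ {n} {i j i′ j′ : Fin n} {p : i Fin.< j} {p′ : i′ Fin.< j′} →
         i ≡ i′ → j ≡ j′ → _≡_ {A = Edge n} (i , j , p) (i′ , j′ , p′)
edge-≡ {p = p} {p′} refl refl = cong (λ r → _ , _ , r) (Finₚ.<-irrelevant p p′)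

endpoints : ∀ {n} (e : Edge n) {x w} → x ∈ₑ e → w ∈ₑ e → x ≢ w →
            (proj₁ e ≡ x × proj₁ (proj₂ e) ≡ w) ⊎ (proj₁ e ≡ w × proj₁ (proj₂ e) ≡ x)
endpoints (i , j , _) (inj₁ x≡i) (inj₁ w≡i) x≢w = ⊥-elim (x≢w (trans x≡i (sym w≡i)))
endpoints (i , j , _) (inj₁ x≡i) (inj₂ w≡j) _   = inj₁ (sym x≡i , sym w≡j)
endpoints (i , j , _) (inj₂ x≡j) (inj₁ w≡i) _   = inj₂ (sym w≡i , sym x≡j)
endpoints (i , j , _) (inj₂ x≡j) (inj₂ w≡j) x≢w = ⊥-elim (x≢w (trans x≡j (sym w≡j)))

edge-unique : ∀ {n} (e e′ : Edge n) {x w} → x ∈ₑ e → w ∈ₑ e → x ∈ₑ e′ → w ∈ₑ e′ → x ≢ w → e ≡ e′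
edge-unique e@(_ , _ , p) e′@(_ , _ , p′) x∈e w∈e x∈e′ w∈e′ x≢w
  with endpoints e x∈e w∈e x≢w | endpoints e′ x∈e′ w∈e′ x≢w
... | inj₁ (a , b)       | inj₁ (a′ , b′)     = edge-≡ (trans a (sym a′)) (trans b (sym b′))
... | inj₂ (a , b)       | inj₂ (a′ , b′)     = edge-≡ (trans a (sym a′)) (trans b (sym b′))
... | inj₁ (refl , refl) | inj₂ (refl , refl) = ⊥-elim (<-asym p p′)
... | inj₂ (refl , refl) | inj₁ (refl , refl) = ⊥-elim (<-asym p p′)

third-∉ₑ : ∀ {n} (e : Edge n) {w x y} → w ∈ₑ e → x ∈ₑ e → w ≢ x → y ≢ w → y ≢ x → ¬ y ∈ₑ e
third-∉ₑ e w∈e x∈e w≢x y≢w y≢x y∈e with endpoints e w∈e x∈e w≢x | y∈e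
... | inj₁ (a , b) | inj₁ c = y≢w (trans c a)
... | inj₁ (a , b) | inj₂ c = y≢x (trans c b)
... | inj₂ (a , b) | inj₁ c = y≢x (trans c a)
... | inj₂ (a , b) | inj₂ c = y≢w (trans c b)

edgeBetween : ∀ {n} (w x : Fin n) → w ≢ x →
              Σ (Edge n) λ e → (∀ (T : Labeling n) → lab T w x ≡ label T e) × w ∈ₑ e × x ∈ₑ e
edgeBetween w x w≢x with Finₚ.<-cmp w x
... | tri< w<x _ _ = (w , x , w<x) , (λ _ → refl) , inj₁ refl , inj₂ refl
... | tri≈ _ w≡x _ = ⊥-elim (w≢x w≡x)
... | tri> _ _ x<w = (x , w , x<w) , (λ _ → refl) , inj₂ refl , inj₁ refl

lab-self : ∀ {n} (T : Labeling n) (x : Fin n) → lab T x x ≡ 0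
lab-self T x with Finₚ.<-cmp x x
... | tri< x<x _ _ = ⊥-elim (<-irrefl refl x<x)
... | tri≈ _ _ _   = refl
... | tri> _ _ x<x = ⊥-elim (<-irrefl refl x<x)

lab-bounds : ∀ {n} (T : Labeling n) (w x : Fin n) → w ≢ x → 1 ≤ lab T w x × lab T w x ≤ numEdges n
lab-bounds {n} T w x w≢x with edgeBetween w x w≢x
... | e , lab≡ , _ = subst (1 ≤_) (sym (lab≡ T)) (s≤s z≤n) , subst (_≤ numEdges n) (sym (lab≡ T)) (toℕ<n (Bijection.to T e))

module Incidence {n : ℕ} (t : Labeling n) where

  E : ℕ
  E = numEdges n

  index : Edge n → Fin E
  index = Bijection.to t

  edgeAt : Fin E → Edge n
  edgeAt k = proj₁ (Bijection.surjective t k)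

  index-edgeAt : ∀ k → index (edgeAt k) ≡ k
  index-edgeAt k = proj₂ (Bijection.surjective t k) refl

  edgeAt-index : ∀ e → edgeAt (index e) ≡ e
  edgeAt-index e = Bijection.injective t (index-edgeAt (index e))

  opposite : Edge n → Fin n → Fin n
  opposite (i , j , _) x with x Fin.≟ i
  ... | yes _ = j
  ... | no _  = i

  opposite-∈ₑ : ∀ e {x} → x ∈ₑ e → opposite e x ∈ₑ e × x ≢ opposite e x
  opposite-∈ₑ (i , j , i<j) {x} x∈e with x Fin.≟ i | x∈e
  ... | yes refl | _         = inj₂ refl , λ i≡j → <-irrefl (cong toℕ i≡j) i<j
  ... | no x≢i   | inj₁ x≡i  = ⊥-elim (x≢i x≡i)
  ... | no _     | inj₂ refl = inj₁ refl , λ j≡i → <-irrefl (cong toℕ (sym j≡i)) i<j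

  Incident : Fin n → ℕ → ℕ → Fin E → Set
  Incident x lo hi k = x ∈ₑ edgeAt k × InWindow lo hi (toℕ k)

  incident? : ∀ x lo hi k → Dec (Incident x lo hi k)
  incident? x lo hi k = (x ∈ₑ? edgeAt k) ×-dec inWindow? lo hi (toℕ k)

  Neighbour : Fin n → ℕ → ℕ → Fin n → Set
  Neighbour x a b w = w ≢ x × InWindow a b (lab t w x)

  neighbour? : ∀ x a b w → Dec (Neighbour x a b w)
  neighbour? x a b w = ¬? (w Fin.≟ x) ×-dec inWindow? a b (lab t w x)

  #neighbours : Fin n → ℕ → ℕ → ℕ
  #neighbours x a b = ΣFin n (λ w → χ (neighbour? x a b w))

  lab-edgeAt : ∀ {x k} → x ∈ₑ edgeAt k → lab t (opposite (edgeAt k) x) x ≡ suc (toℕ k)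
  lab-edgeAt {x} {k} x∈eₖ with opposite-∈ₑ (edgeAt k) x∈eₖ
  ... | y∈eₖ , x≢y with edgeBetween (opposite (edgeAt k) x) x (λ y≡x → x≢y (sym y≡x))
  ...   | e , lab≡ , y∈e , x∈e = begin
    lab t (opposite (edgeAt k) x) x  ≡⟨ lab≡ t ⟩
    suc (toℕ (index e))              ≡⟨ cong (λ e → suc (toℕ (index e))) e≡eₖ ⟩
    suc (toℕ (index (edgeAt k)))     ≡⟨ cong (λ k → suc (toℕ k)) (index-edgeAt k) ⟩
    suc (toℕ k)                      ∎
    where
    open ≡-Reasoning
    e≡eₖ : e ≡ edgeAt k
    e≡eₖ = edge-unique e (edgeAt k) y∈e x∈e y∈eₖ x∈eₖ (λ y≡x → x≢y (sym y≡x))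

  opposite-injective : ∀ {x k k′} → x ∈ₑ edgeAt k → x ∈ₑ edgeAt k′ →
                       opposite (edgeAt k) x ≡ opposite (edgeAt k′) x → k ≡ k′
  opposite-injective {x} {k} {k′} x∈eₖ x∈eₖ′ eq with opposite-∈ₑ (edgeAt k) x∈eₖ | opposite-∈ₑ (edgeAt k′) x∈eₖ′
  ... | y∈eₖ , x≢y | y′∈eₖ′ , _ = begin
    k                  ≡⟨ sym (index-edgeAt k) ⟩
    index (edgeAt k)   ≡⟨ cong index eₖ≡eₖ′ ⟩
    index (edgeAt k′)  ≡⟨ index-edgeAt k′ ⟩
    k′                 ∎
    where
    open ≡-Reasoning
    eₖ≡eₖ′ : edgeAt k ≡ edgeAt k′
    eₖ≡eₖ′ = edge-unique (edgeAt k) (edgeAt k′) x∈eₖ y∈eₖ x∈eₖ′ (subst (_∈ₑ edgeAt k′) (sym eq) y′∈eₖ′) x≢y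

  #incident≤#neighbours : ∀ x lo hi → ΣFin E (λ k → χ (incident? x lo hi k)) ≤ #neighbours x (suc lo) (suc hi)
  #incident≤#neighbours x lo hi = begin
    ΣFin E (λ k → χ (incident? x lo hi k))               ≤⟨ ΣFin-mono-≤ E through-opposite ⟩
    ΣFin E (λ k → ΣFin n (λ w → χ (via? k w)))           ≡⟨ ΣFin-comm E n (λ k w → χ (via? k w)) ⟩
    ΣFin n (λ w → ΣFin E (λ k → χ (via? k w)))           ≤⟨ ΣFin-mono-≤ n at-most-one ⟩
    #neighbours x (suc lo) (suc hi)                      ∎
    where
    open ≤-Reasoning
    Via : Fin E → Fin n → Set
    Via k w = Incident x lo hi k × opposite (edgeAt k) x ≡ w
    via? : ∀ k w → Dec (Via k w)
    via? k w = incident? x lo hi k ×-dec (opposite (edgeAt k) x Fin.≟ w)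
    through-opposite : ∀ k → χ (incident? x lo hi k) ≤ ΣFin n (λ w → χ (via? k w))
    through-opposite k = ≤-trans (χ-mono (incident? x lo hi k) (via? k _) (λ inc → inc , refl))
                                 (term-≤-ΣFin n (λ w → χ (via? k w)) (opposite (edgeAt k) x))
    via-unique : ∀ w k k′ → Via k w → Via k′ w → k ≡ k′
    via-unique w k k′ ((x∈eₖ , _) , refl) ((x∈eₖ′ , _) , eq) = opposite-injective x∈eₖ x∈eₖ′ (sym eq)
    via⇒neighbour : ∀ w k → Via k w → Neighbour x (suc lo) (suc hi) w
    via⇒neighbour w k ((x∈eₖ , lo≤k , k<hi) , refl) =
      (λ y≡x → proj₂ (opposite-∈ₑ (edgeAt k) x∈eₖ) (sym y≡x)) ,
      subst (InWindow (suc lo) (suc hi)) (sym (lab-edgeAt x∈eₖ)) (s≤s lo≤k , s≤s k<hi)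
    at-most-one : ∀ w → ΣFin E (λ k → χ (via? k w)) ≤ χ (neighbour? x (suc lo) (suc hi) w)
    at-most-one w = ΣFin-χ-unique E (λ k → via? k w) (neighbour? x (suc lo) (suc hi) w) (via-unique w) (via⇒neighbour w)

module Blocks {n : ℕ} (t : Labeling n) (p m : ℕ) (I : Fin m → Interval) (decomposition : IsDecomposition n m I)
              (long : ∀ i → 4 * p ≤ len (I i)) (thin : ∀ (v : Fin n) i → countSI t v (I i) ≤ 2) where

  open Incidence t

  cover : ∀ ℓ → 1 ≤ ℓ × ℓ ≤ E → ∃ λ i → ℓ ∈I I i
  cover = proj₁ decomposition

  disjoint : ∀ i j ℓ → ℓ ∈I I i → ℓ ∈I I j → i ≡ j
  disjoint = proj₂ (proj₂ decomposition)

  between-blocks : ∀ {a b ℓ i j} → a ≤ ℓ → ℓ ≤ b → b ≤ a + 4 * p → a ∈I I i → b ∈I I j →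
                   1 ≤ ℓ × ℓ ≤ E → ℓ ∈I I i ⊎ ℓ ∈I I j
  between-blocks {a} {b} {ℓ} {i} {j} a≤ℓ ℓ≤b b≤a+4p a∈i b∈j ℓ∈[1,E] with cover ℓ ℓ∈[1,E]
  ... | l , ℓ∈l@(start≤ℓ , ℓ<end) with proj₁ (I l) ≤? a
  ...   | yes start≤a = inj₁ (subst (λ i → ℓ ∈I I i) (disjoint l i a (start≤a , ≤-<-trans a≤ℓ ℓ<end) a∈i) ℓ∈l)
  ...   | no start≰a  = inj₂ (subst (λ j → ℓ ∈I I j) (disjoint l j b (≤-trans start≤ℓ ℓ≤b , b<end) b∈j) ℓ∈l)
    where
    b<end : b < proj₁ (I l) + proj₂ (I l)
    b<end = ≤-<-trans b≤a+4p (+-mono-<-≤ (≰⇒> start≰a) (long l))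

  #neighbours-short-window : ∀ x a c → c ≤ suc (a + 4 * p) → #neighbours x a c ≤ 4
  #neighbours-short-window x a c c≤1+a+4p with any? (neighbour? x a c)
  ... | no none = ≤-trans (≤-reflexive (ΣFin-zero n (λ w → χ-no (neighbour? x a c w) (λ nb → none (w , nb))))) z≤n
  ... | yes (w₀ , w₀≢x , a≤ℓ₀ , ℓ₀<c) = begin
    #neighbours x a c                         ≤⟨ ΣFin-mono-≤ n in-two-blocks ⟩
    ΣFin n (λ w → inBlock i w + inBlock j w)  ≡⟨ ΣFin-distrib-+ n (inBlock i) (inBlock j) ⟩
    countSI t x (I i) + countSI t x (I j)     ≤⟨ +-mono-≤ (thin x i) (thin x j) ⟩
    4                                         ∎
    where
    open ≤-Reasoning
    -- The label of w₀ makes the clamped endpoints a′ and b′ genuine labels, so both lie in blocks.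
    ℓ₀-bounds = lab-bounds t w₀ x w₀≢x
    a′ = a ⊔ 1
    b′ = ℕ.pred c ⊓ E
    a′∈[1,E] : 1 ≤ a′ × a′ ≤ E
    a′∈[1,E] = m≤n⊔m a 1 , ⊔-lub (≤-trans a≤ℓ₀ (proj₂ ℓ₀-bounds)) (≤-trans (proj₁ ℓ₀-bounds) (proj₂ ℓ₀-bounds))
    b′∈[1,E] : 1 ≤ b′ × b′ ≤ E
    b′∈[1,E] = ≤-trans (proj₁ ℓ₀-bounds) (⊓-glb (<⇒≤pred ℓ₀<c) (proj₂ ℓ₀-bounds)) , m⊓n≤n _ E
    i = proj₁ (cover a′ a′∈[1,E])
    j = proj₁ (cover b′ b′∈[1,E])
    b′≤a′+4p : b′ ≤ a′ + 4 * p
    b′≤a′+4p = ≤-trans (m⊓n≤m _ E) (≤-trans (pred-mono-≤ c≤1+a+4p) (+-monoˡ-≤ (4 * p) (m≤m⊔n a 1)))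
    inBlock : Fin m → Fin n → ℕ
    inBlock k w = Data.Bool.if ⌊ x Fin.≟ w ⌋ then 0 else (Data.Bool.if ⌊ lab t w x ∈I? I k ⌋ then 1 else 0)
    in-two-blocks : ∀ w → χ (neighbour? x a c w) ≤ inBlock i w + inBlock j w
    in-two-blocks w with x Fin.≟ w
    ... | yes x≡w = ≤-reflexive (χ-no (neighbour? x a c w) (λ nb → proj₁ nb (sym x≡w)))
    ... | no _    = subst₂ (λ y z → χ (neighbour? x a c w) ≤ y + z) (sym (if-χ (lab t w x ∈I? I i))) (sym (if-χ (lab t w x ∈I? I j)))
                      (χ-≤-⊎ (neighbour? x a c w) (lab t w x ∈I? I i) (lab t w x ∈I? I j) in-i-or-j)
      where
      in-i-or-j : Neighbour x a c w → lab t w x ∈I I i ⊎ lab t w x ∈I I j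
      in-i-or-j (w≢x , a≤ℓ , ℓ<c) = between-blocks (⊔-lub a≤ℓ (proj₁ ℓ-bounds)) (⊓-glb (<⇒≤pred ℓ<c) (proj₂ ℓ-bounds)) b′≤a′+4p
                                      (proj₂ (cover a′ a′∈[1,E])) (proj₂ (cover b′ b′∈[1,E])) ℓ-bounds
        where ℓ-bounds = lab-bounds t w x w≢x

-- The p-swap

module Swap (n′ : ℕ) (t : Labeling (2 + n′)) (g m : ℕ) (I : Fin m → Interval) (decomposition : IsDecomposition (2 + n′) m I)
            (long : ∀ i → 4 * (g + 9) ≤ len (I i)) (thin : ∀ (v : Fin (2 + n′)) i → countSI t v (I i) ≤ 2) where

  n q : ℕ
  n = 2 + n′
  q = g + 5

  u v : Fin n
  u = Fin.zero
  v = Fin.suc Fin.zero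

  open Incidence t
  open Blocks t (g + 9) m I decomposition long thin

  role : Fin E → Role
  role k = roleOf (u ∈ₑ? edgeAt k) (v ∈ₑ? edgeAt k)

  open RoleSort E q role

  1≤q : 1 ≤ q
  1≤q = ≤-trans (s≤s z≤n) (m≤n+m 5 g)

  q+q≤4p : q + q ≤ 4 * (g + 9)
  q+q≤4p = ≤-trans (m≤m+n (q + q) (g + g + 26)) (≤-reflexive (identity g))
    where
    identity : ∀ g → g + 5 + (g + 5) + (g + g + 26) ≡ 4 * (g + 9)
    identity = solve-∀

  endpoint-sparse : ∀ c x → (∀ k → role k ≡ c → x ∈ₑ edgeAt k) → Sparse c
  endpoint-sparse c x c⇒x∈ lo hi hi≤lo+2q = begin
    #role c lo hi                                ≤⟨ ΣFin-χ-mono E (roleWindow? c lo hi) (incident? x lo hi) (λ k (rk , w) → c⇒x∈ k rk , w) ⟩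
    ΣFin E (λ k → χ (incident? x lo hi k))       ≤⟨ #incident≤#neighbours x lo hi ⟩
    #neighbours x (suc lo) (suc hi)              ≤⟨ #neighbours-short-window x (suc lo) (suc hi) short ⟩
    4                                            ∎
    where
    open ≤-Reasoning
    short : suc hi ≤ suc (suc lo + 4 * (g + 9))
    short = s≤s (≤-trans hi≤lo+2q (≤-trans (+-monoʳ-≤ lo q+q≤4p) (n≤1+n _)))

  open Displacement (endpoint-sparse raised u (λ k → roleOf-raised⇒ (u ∈ₑ? edgeAt k) (v ∈ₑ? edgeAt k)))
                    (endpoint-sparse lowered v (λ k → roleOf-lowered⇒ (u ∈ₑ? edgeAt k) (v ∈ₑ? edgeAt k)))

  σ : Fin E ⤖ Fin E
  σ = proj₁ rankPermutation

  t′ : Labeling n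
  t′ = σ ⤖-∘ t

  label-t′ : ∀ e → label t′ e ≡ suc (rank (index e))
  label-t′ e = cong suc (proj₂ rankPermutation (index e))

  t′-isSwap : IsPSwapOf (g + 9) t t′
  t′-isSwap e = subst (λ x → ∣ label t e - x ∣ ≤ g + 9) (sym (label-t′ e))
    (subst (λ d → ∣ toℕ (index e) - rank (index e) ∣ ≤ d) (+-assoc g 5 4)
      (∣m-n∣≤o (proj₂ (rank-displacement (index e))) (proj₁ (rank-displacement (index e)))))

  module _ {w x : Fin n} (w≢x : w ≢ x) where

    edgeIndex : Fin E
    edgeIndex = index (proj₁ (edgeBetween w x w≢x))

    lab-edgeIndex : lab t w x ≡ suc (toℕ edgeIndex)
    lab-edgeIndex = proj₁ (proj₂ (edgeBetween w x w≢x)) t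

    lab′-edgeIndex : lab t′ w x ≡ suc (rank edgeIndex)
    lab′-edgeIndex = trans (proj₁ (proj₂ (edgeBetween w x w≢x)) t′) (label-t′ (proj₁ (edgeBetween w x w≢x)))

    ∈-edgeIndex : w ∈ₑ edgeAt edgeIndex × x ∈ₑ edgeAt edgeIndex
    ∈-edgeIndex = in-edgeAt (proj₁ (proj₂ (proj₂ (edgeBetween w x w≢x)))) , in-edgeAt (proj₂ (proj₂ (proj₂ (edgeBetween w x w≢x))))
      where
      in-edgeAt : ∀ {y} → y ∈ₑ proj₁ (edgeBetween w x w≢x) → y ∈ₑ edgeAt edgeIndex
      in-edgeAt {y} = subst (y ∈ₑ_) (sym (edgeAt-index _))

  u≢v : u ≢ v
  u≢v ()

  Good-u : Fin n → Set
  Good-u w = w ≢ u × w ≢ v × lab t w u + q ≤ suc E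

  good-u? : ∀ w → Dec (Good-u w)
  good-u? w = ¬? (w Fin.≟ u) ×-dec ¬? (w Fin.≟ v) ×-dec (lab t w u + q ≤? suc E)

  Good-v : Fin n → Set
  Good-v w = w ≢ u × w ≢ v × q < lab t w v

  good-v? : ∀ w → Dec (Good-v w)
  good-v? w = ¬? (w Fin.≟ u) ×-dec ¬? (w Fin.≟ v) ×-dec (q <? lab t w v)

  raised-toward-u : ∀ {w} (w≢u : w ≢ u) → w ≢ v → role (edgeIndex w≢u) ≡ raised
  raised-toward-u w≢u w≢v =
    roleOf-raised (u ∈ₑ? edgeAt k) (v ∈ₑ? edgeAt k) u∈eₖ
      (third-∉ₑ (edgeAt k) w∈eₖ u∈eₖ w≢u (λ v≡w → w≢v (sym v≡w)) (λ v≡u → u≢v (sym v≡u)))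
    where
    k = edgeIndex w≢u
    w∈eₖ = proj₁ (∈-edgeIndex w≢u)
    u∈eₖ = proj₂ (∈-edgeIndex w≢u)

  lowered-toward-v : ∀ {w} (w≢v : w ≢ v) → w ≢ u → role (edgeIndex w≢v) ≡ lowered
  lowered-toward-v w≢v w≢u =
    roleOf-lowered (u ∈ₑ? edgeAt k) (v ∈ₑ? edgeAt k)
      (third-∉ₑ (edgeAt k) w∈eₖ v∈eₖ w≢v (λ u≡w → w≢u (sym u≡w)) u≢v) v∈eₖ
    where
    k = edgeIndex w≢v
    w∈eₖ = proj₁ (∈-edgeIndex w≢v)
    v∈eₖ = proj₂ (∈-edgeIndex w≢v)

  kept-uv : ∀ {w x} (w≢x : w ≢ x) → u ∈ₑ edgeAt (edgeIndex w≢x) → v ∈ₑ edgeAt (edgeIndex w≢x) → role (edgeIndex w≢x) ≡ kept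
  kept-uv w≢x = roleOf-kept (u ∈ₑ? edgeAt (edgeIndex w≢x)) (v ∈ₑ? edgeAt (edgeIndex w≢x))

  u-labels-rise : ∀ w → lab t w u ≤ lab t′ w u + 4 * χ (w Fin.≟ v)
  u-labels-rise w = byVertex (w Fin.≟ u) (w Fin.≟ v)
    where
    byVertex : Dec (w ≡ u) → (w≟v : Dec (w ≡ v)) → lab t w u ≤ lab t′ w u + 4 * χ w≟v
    byVertex (yes refl) w≟v = subst (_≤ lab t′ u u + 4 * χ w≟v) (sym (lab-self t u)) z≤n
    byVertex (no w≢u)   w≟v = subst₂ (λ a b → a ≤ b + 4 * χ w≟v) (sym (lab-edgeIndex w≢u)) (sym (lab′-edgeIndex w≢u))
                                (s≤s (bound w≟v))
      where
      bound : (w≟v : Dec (w ≡ v)) → toℕ (edgeIndex w≢u) ≤ rank (edgeIndex w≢u) + 4 * χ w≟v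
      bound (yes refl) = index≤rank+ (kept-#overtaken (kept-uv w≢u (proj₂ (∈-edgeIndex w≢u)) (proj₁ (∈-edgeIndex w≢u))))
      bound (no w≢v)   = ≤-trans (raised-index≤rank (raised-toward-u w≢u w≢v)) (m≤m+n _ _)

  u-labels-gain : ∀ w → Good-u w → lab t w u + g ≤ lab t′ w u
  u-labels-gain w (w≢u , w≢v , lab+q≤1+E) =
    subst₂ (λ a b → a + g ≤ b) (sym (lab-edgeIndex w≢u)) (sym (lab′-edgeIndex w≢u)) (s≤s (+-cancelʳ-≤ 5 (toℕ k + g) (rank k) k+g+5≤rank+5))
    where
    k = edgeIndex w≢u
    k+g+5≤rank+5 : toℕ k + g + 5 ≤ rank k + 5
    k+g+5≤rank+5 = subst (_≤ rank k + 5) (sym (+-assoc (toℕ k) g 5))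
      (raised-gain (raised-toward-u w≢u w≢v) 1≤q (≤-pred (subst (λ l → l + q ≤ suc E) (lab-edgeIndex w≢u) lab+q≤1+E)))

  v-labels-fall : ∀ w → lab t′ w v ≤ lab t w v + 4 * χ (w Fin.≟ u)
  v-labels-fall w = byVertex (w Fin.≟ v) (w Fin.≟ u)
    where
    byVertex : Dec (w ≡ v) → (w≟u : Dec (w ≡ u)) → lab t′ w v ≤ lab t w v + 4 * χ w≟u
    byVertex (yes refl) w≟u = subst (_≤ lab t v v + 4 * χ w≟u) (sym (lab-self t′ v)) z≤n
    byVertex (no w≢v)   w≟u = subst₂ (λ a b → a ≤ b + 4 * χ w≟u) (sym (lab′-edgeIndex w≢v)) (sym (lab-edgeIndex w≢v))
                                (s≤s (bound w≟u))
      where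
      bound : (w≟u : Dec (w ≡ u)) → rank (edgeIndex w≢v) ≤ toℕ (edgeIndex w≢v) + 4 * χ w≟u
      bound (yes refl) = rank≤index+ (kept-#overtaking (kept-uv w≢v (proj₁ (∈-edgeIndex w≢v)) (proj₂ (∈-edgeIndex w≢v))))
      bound (no w≢u)   = ≤-trans (lowered-rank≤index (lowered-toward-v w≢v w≢u)) (m≤m+n _ _)

  v-labels-drop : ∀ w → Good-v w → lab t′ w v + g ≤ lab t w v
  v-labels-drop w (w≢u , w≢v , q<lab) =
    subst₂ (λ a b → a + g ≤ b) (sym (lab′-edgeIndex w≢v)) (sym (lab-edgeIndex w≢v)) (s≤s (+-cancelʳ-≤ 5 (rank k + g) (toℕ k) rank+g+5≤k+5))
    where
    k = edgeIndex w≢v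
    rank+g+5≤k+5 : rank k + g + 5 ≤ toℕ k + 5
    rank+g+5≤k+5 = subst (_≤ toℕ k + 5) (sym (+-assoc (rank k) g 5))
      (lowered-gain (lowered-toward-v w≢v w≢u) 1≤q (≤-pred (subst (q <_) (lab-edgeIndex w≢v) q<lab)))

  s-u-rises : s t u + g * ΣFin n (λ w → χ (good-u? w)) ≤ s t′ u + 4
  s-u-rises = ΣFin-weighted-gain n good-u? v (λ w → lab t w u) (λ w → lab t′ w u) g 4 u-labels-rise u-labels-gain

  s-v-falls : s t′ v + g * ΣFin n (λ w → χ (good-v? w)) ≤ s t v + 4
  s-v-falls = ΣFin-weighted-gain n good-v? u (λ w → lab t′ w v) (λ w → lab t w v) g 4 v-labels-fall v-labels-drop

  others-good-or-bad : ∀ {G B : Fin n → Set} (G? : ∀ w → Dec (G w)) (B? : ∀ w → Dec (B w)) →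
                       (∀ w → w ≢ u → w ≢ v → G w ⊎ B w) →
                       n′ ≤ ΣFin n (λ w → χ (G? w)) + ΣFin n (λ w → χ (B? w))
  others-good-or-bad G? B? split = ≤-trans (≤-reflexive (sym #others))
    (ΣFin-χ-⊎ n (λ w → ¬? (w Fin.≟ u) ×-dec ¬? (w Fin.≟ v)) G? B? (λ w (w≢u , w≢v) → split w w≢u w≢v))
    where
    #others : ΣFin n (λ w → χ (¬? (w Fin.≟ u) ×-dec ¬? (w Fin.≟ v))) ≡ n′
    #others = trans (ΣFin-cong n′ (λ i → χ-yes (¬? (Fin.suc (Fin.suc i) Fin.≟ u) ×-dec ¬? (Fin.suc (Fin.suc i) Fin.≟ v)) ((λ ()) , (λ ()))))
                    (trans (ΣFin-const n′ 1) (*-identityʳ n′))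

  q≤4p : q ≤ 4 * (g + 9)
  q≤4p = ≤-trans (m≤m+n q q) q+q≤4p

  many-good-u : n′ ≤ ΣFin n (λ w → χ (good-u? w)) + 4
  many-good-u = ≤-trans (others-good-or-bad good-u? (neighbour? u top (suc (suc E))) split)
                        (+-monoʳ-≤ _ (#neighbours-short-window u top (suc (suc E)) short))
    where
    top = suc (suc E) ∸ q
    split : ∀ w → w ≢ u → w ≢ v → Good-u w ⊎ Neighbour u top (suc (suc E)) w
    split w w≢u w≢v = byFit (lab t w u + q ≤? suc E)
      where
      byFit : Dec (lab t w u + q ≤ suc E) → Good-u w ⊎ Neighbour u top (suc (suc E)) w
      byFit (yes fits) = inj₁ (w≢u , w≢v , fits)
      byFit (no ¬fits) = inj₂ (w≢u , m<n+o⇒1+m∸o≤n (suc E) (lab t w u) q (≰⇒> ¬fits) ,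
                                s≤s (≤-trans (proj₂ (lab-bounds t w u w≢u)) (n≤1+n E)))
    short : suc (suc E) ≤ suc (top + 4 * (g + 9))
    short = s≤s (≤-trans (m≤1+m∸n+n (suc E) q) (+-monoʳ-≤ top q≤4p))

  many-good-v : n′ ≤ ΣFin n (λ w → χ (good-v? w)) + 4
  many-good-v = ≤-trans (others-good-or-bad good-v? (neighbour? v 0 (suc q)) split)
                        (+-monoʳ-≤ _ (#neighbours-short-window v 0 (suc q) (s≤s q≤4p)))
    where
    split : ∀ w → w ≢ u → w ≢ v → Good-v w ⊎ Neighbour v 0 (suc q) w
    split w w≢u w≢v = bySize (q <? lab t w v)
      where
      bySize : Dec (q < lab t w v) → Good-v w ⊎ Neighbour v 0 (suc q) w
      bySize (yes q<lab) = inj₁ (w≢u , w≢v , q<lab)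
      bySize (no q≮lab)  = inj₂ (w≢v , z≤n , s≤s (≮⇒≥ q≮lab))

  gap-bound : ∀ α → ∣ s t u - s t v ∣ ≤ α → 2 * g * n′ ≤ ∣ s t′ u - s t′ v ∣ + α + 8 + 8 * g
  gap-bound α almost-magic = begin
    2 * g * n′                   ≡⟨ double g n′ ⟩
    g * n′ + g * n′              ≤⟨ +-mono-≤ (*-monoʳ-≤ g many-good-u) (*-monoʳ-≤ g many-good-v) ⟩
    g * (X + 4) + g * (Y + 4)    ≡⟨ expand g X Y ⟩
    g * X + g * Y + 8 * g        ≤⟨ +-monoˡ-≤ (8 * g) (+-cancelˡ-≤ B′ (g * X + g * Y) (D + α + 8) shifted) ⟩
    D + α + 8 + 8 * g            ∎
    where
    open ≤-Reasoning
    A = s t u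
    B = s t v
    A′ = s t′ u
    B′ = s t′ v
    X = ΣFin n (λ w → χ (good-u? w))
    Y = ΣFin n (λ w → χ (good-v? w))
    D = ∣ A′ - B′ ∣
    double : ∀ g n → 2 * g * n ≡ g * n + g * n
    double = solve-∀
    expand : ∀ g X Y → g * (X + 4) + g * (Y + 4) ≡ g * X + g * Y + 8 * g
    expand = solve-∀
    shifted : B′ + (g * X + g * Y) ≤ B′ + (D + α + 8)
    shifted = begin
      B′ + (g * X + g * Y)       ≡⟨ swap-gains B′ (g * X) (g * Y) ⟩
      B′ + g * Y + g * X         ≤⟨ +-monoˡ-≤ (g * X) s-v-falls ⟩
      B + 4 + g * X              ≤⟨ +-monoˡ-≤ (g * X) (+-monoˡ-≤ 4 (≤-trans (m≤n+∣n-m∣ B A) (+-monoʳ-≤ A almost-magic))) ⟩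
      A + α + 4 + g * X          ≡⟨ regroup A α (g * X) ⟩
      A + g * X + (α + 4)        ≤⟨ +-monoˡ-≤ (α + 4) s-u-rises ⟩
      A′ + 4 + (α + 4)           ≤⟨ +-monoˡ-≤ (α + 4) (+-monoˡ-≤ 4 (m≤n+∣m-n∣ A′ B′)) ⟩
      B′ + D + 4 + (α + 4)       ≡⟨ collect B′ D α ⟩
      B′ + (D + α + 8)           ∎
      where
      swap-gains : ∀ b x y → b + (x + y) ≡ b + y + x
      swap-gains = solve-∀
      regroup : ∀ a α x → a + α + 4 + x ≡ a + x + (α + 4)
      regroup = solve-∀
      collect : ∀ b d α → b + d + 4 + (α + 4) ≡ b + (d + α + 8)
      collect = solve-∀

-- From the gap to the ratio

toℚᵘ-ℕtoℚ : ∀ X → ℚ.toℚᵘ (ℕtoℚ X) ℚᵘ.≃ mkℚᵘ (ℤ.+ X) 0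
toℚᵘ-ℕtoℚ X = ℚP.toℚᵘ-fromℚᵘ (mkℚᵘ (ℤ.+ X) 0)

[1-1/[1+d]]*X≤Y : ∀ d X Y → suc d * X ≤ suc d * Y + X →
                  (mkℚᵘ (ℤ.+ 1) 0 ℚᵘ.- mkℚᵘ (ℤ.+ 1) d) ℚᵘ.* mkℚᵘ (ℤ.+ X) 0 ℚᵘ.≤ mkℚᵘ (ℤ.+ Y) 0
[1-1/[1+d]]*X≤Y d X Y bX≤bY+X = *≤* (subst₂ ℤ._≤_ (sym (trans (cong (ℤ._* ℤ.+ 1) numerator) (sym (ℤP.pos-* (d * X) 1))))
                                                   (sym (trans (cong (ℤ.+ Y ℤ.*_) denominator) (sym (ℤP.pos-* Y (suc d)))))
                                                   (ℤ.+≤+ dX≤Yb))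
  where
  numerator : ℚᵘ.↥ ((mkℚᵘ (ℤ.+ 1) 0 ℚᵘ.- mkℚᵘ (ℤ.+ 1) d) ℚᵘ.* mkℚᵘ (ℤ.+ X) 0) ≡ ℤ.+ (d * X)
  numerator = trans (sym (ℤP.pos-* (d + 0 * suc d) X)) (cong (λ z → ℤ.+ (z * X)) (+-identityʳ d))
  denominator : ℚᵘ.↧ ((mkℚᵘ (ℤ.+ 1) 0 ℚᵘ.- mkℚᵘ (ℤ.+ 1) d) ℚᵘ.* mkℚᵘ (ℤ.+ X) 0) ≡ ℤ.+ (suc d)
  denominator = cong (λ z → ℤ.+ suc z) (trans (*-identityʳ (d + 0 * suc d)) (+-identityʳ d))
  dX≤Yb : d * X * 1 ≤ Y * suc d
  dX≤Yb = subst₂ _≤_ (sym (*-identityʳ (d * X))) (*-comm (suc d) Y)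
            (+-cancelʳ-≤ X (d * X) (suc d * Y) (subst (_≤ suc d * Y + X) (+-comm X (d * X)) bX≤bY+X))

ratio-threshold : ∀ (c ε : ℚ) → c ℚ.≤ 1ℚ → ℚ.Positive ε →
                  ∃ λ b → ∀ X Y → b * X ≤ b * Y + X → (c ℚ.- ε) ℚ.* ℕtoℚ X ℚ.≤ ℕtoℚ Y
-- b is the denominator of ε, so that c − ε ≤ 1 − 1/b.
ratio-threshold c (mkℚ ℤ.+[1+ a ] d coprime) c≤1 _ = suc d , λ X Y bX≤bY+X → ℚP.toℚᵘ-cancel-≤ (
  ℚᵘP.≤-respˡ-≃ (ℚᵘP.≃-sym (toℚᵘ-[c-ε]*X X)) (ℚᵘP.≤-respʳ-≃ (ℚᵘP.≃-sym (toℚᵘ-ℕtoℚ Y))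
    (ℚᵘP.≤-trans (ℚᵘP.*-monoˡ-≤-nonNeg (mkℚᵘ (ℤ.+ X) 0) (ℚᵘP.+-mono-≤ (ℚP.toℚᵘ-mono-≤ c≤1) (ℚᵘP.neg-mono-≤ 1/b≤ε)))
                 ([1-1/[1+d]]*X≤Y d X Y bX≤bY+X))))
  where
  ε = mkℚ ℤ.+[1+ a ] d coprime
  εᵘ = mkℚᵘ ℤ.+[1+ a ] d
  1/b≤ε : mkℚᵘ (ℤ.+ 1) d ℚᵘ.≤ εᵘ
  1/b≤ε = *≤* (subst₂ ℤ._≤_ (ℤP.pos-* 1 (suc d)) (ℤP.pos-* (suc a) (suc d)) (ℤ.+≤+ (*-monoˡ-≤ (suc d) {1} {suc a} (s≤s z≤n))))
  toℚᵘ-[c-ε]*X : ∀ X → ℚ.toℚᵘ ((c ℚ.- ε) ℚ.* ℕtoℚ X) ℚᵘ.≃ (ℚ.toℚᵘ c ℚᵘ.- εᵘ) ℚᵘ.* mkℚᵘ (ℤ.+ X) 0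
  toℚᵘ-[c-ε]*X X = ℚᵘP.≃-trans (ℚP.toℚᵘ-homo-* (c ℚ.- ε) (ℕtoℚ X))
    (ℚᵘP.*-cong (ℚᵘP.≃-trans (ℚP.toℚᵘ-homo-+ c (ℚ.- ε)) (ℚᵘP.+-congʳ (ℚ.toℚᵘ c) (ℚP.toℚᵘ-homo‿- ε))) (toℚᵘ-ℕtoℚ X))

1-x≤1 : ∀ x → ℚ.NonNegative x → 1ℚ ℚ.- x ℚ.≤ 1ℚ
1-x≤1 x x≥0 = ℚP.≤-trans (ℚP.+-monoʳ-≤ 1ℚ (ℚP.neg-antimono-≤ (ℚP.nonNegative⁻¹ x {{x≥0}})))
                         (ℚP.≤-reflexive (ℚP.+-identityʳ 1ℚ))

ratio-arith : ∀ b C α g n′ gap → α ≤ C * (2 + n′) → g ≤ 2 + n′ → b * (C + 38) ≤ g →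
              2 * g * n′ ≤ gap + α + 8 + 8 * g →
              b * (2 * (g + 9) * (2 + n′)) ≤ b * gap + 2 * (g + 9) * (2 + n′)
ratio-arith b C α g n′ gap α≤Cn g≤n b[C+38]≤g gap-bound = begin
  b * (2 * (g + 9) * N)                                           ≡⟨ e₁ b g n′ ⟩
  b * (2 * g * n′) + (4 * b * g + 18 * b * N)                     ≤⟨ +-monoˡ-≤ (4 * b * g + 18 * b * N) (*-monoʳ-≤ b gap-bound) ⟩
  b * (gap + α + 8 + 8 * g) + (4 * b * g + 18 * b * N)            ≡⟨ e₂ b gap α g n′ ⟩
  b * gap + (b * α + 12 * b * g + 8 * b * 1 + 18 * b * N)         ≤⟨ +-monoʳ-≤ (b * gap) (+-monoˡ-≤ (18 * b * N) linear-in-N) ⟩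
  b * gap + (b * (C * N) + 12 * b * N + 8 * b * N + 18 * b * N)   ≡⟨ e₃ b gap C n′ ⟩
  b * gap + b * (C + 38) * N                                      ≤⟨ +-monoʳ-≤ (b * gap) (*-monoˡ-≤ N (≤-trans b[C+38]≤g (m≤m+n g (g + 18)))) ⟩
  b * gap + (g + (g + 18)) * N                                    ≡⟨ cong (λ x → b * gap + x * N) (e₄ g) ⟩
  b * gap + 2 * (g + 9) * N                                       ∎
  where
  open ≤-Reasoning
  N = 2 + n′
  linear-in-N : b * α + 12 * b * g + 8 * b * 1 ≤ b * (C * N) + 12 * b * N + 8 * b * N
  linear-in-N = +-mono-≤ (+-mono-≤ (*-monoʳ-≤ b α≤Cn) (*-monoʳ-≤ (12 * b) g≤n)) (*-monoʳ-≤ (8 * b) (s≤s z≤n))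
  e₁ : ∀ b g n′ → b * (2 * (g + 9) * (2 + n′)) ≡ b * (2 * g * n′) + (4 * b * g + 18 * b * (2 + n′))
  e₁ = solve-∀
  e₂ : ∀ b gap α g n′ → b * (gap + α + 8 + 8 * g) + (4 * b * g + 18 * b * (2 + n′))
                        ≡ b * gap + (b * α + 12 * b * g + 8 * b * 1 + 18 * b * (2 + n′))
  e₂ = solve-∀
  e₃ : ∀ b gap C n′ → b * gap + (b * (C * (2 + n′)) + 12 * b * (2 + n′) + 8 * b * (2 + n′) + 18 * b * (2 + n′))
                      ≡ b * gap + b * (C + 38) * (2 + n′)
  e₃ = solve-∀
  e₄ : ∀ g → g + (g + 18) ≡ 2 * (g + 9)
  e₄ = solve-∀

ThinDecomposition : (n : ℕ) → Labeling n → ℕ → Set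
ThinDecomposition n t p = ∃ λ m → ∃ λ (I : Fin m → Interval) → IsDecomposition n m I
  × (∀ i → 4 * p ≤ len (I i))
  × (∀ (v : Fin n) i → countSI t v (I i) ≤ 2)

swap-ratio : ∀ {c ε : ℚ} b → (∀ X Y → b * X ≤ b * Y + X → (c ℚ.- ε) ℚ.* ℕtoℚ X ℚ.≤ ℕtoℚ Y) →
             ∀ C {n} (t : Labeling n) α p → AlmostSupermagic α t → ThinDecomposition n t p →
             α ≤ C * n → p ≤ n → b * (C + 38) + 9 ≤ p → RatioAtLeast p t (c ℚ.- ε)
swap-ratio b threshold C {zero}        t α p _ _ _ p≤n big = contradiction (≤-trans (m≤n+m 9 (b * (C + 38))) (≤-trans big p≤n)) λ ()
swap-ratio b threshold C {suc zero}    t α p _ _ _ p≤n big = contradiction (≤-trans (m≤n+m 9 (b * (C + 38))) (≤-trans big p≤n)) λ { (s≤s ()) }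
swap-ratio {c} {ε} b threshold C {suc (suc n′)} t α p magic (m , I , decomposition , long , thin) α≤Cn p≤n big =
  forGap (p ∸ 9) (m∸n+n≡m (≤-trans (m≤n+m 9 (b * (C + 38))) big)) long p≤n big
  where
  forGap : ∀ g → g + 9 ≡ p → (∀ i → 4 * p ≤ len (I i)) → p ≤ 2 + n′ → b * (C + 38) + 9 ≤ p → RatioAtLeast p t (c ℚ.- ε)
  forGap g refl long p≤n big =
    positive , t′ , t′-isSwap , u , v , u≢v ,
    threshold (2 * (g + 9) * (2 + n′)) ∣ s t′ u - s t′ v ∣
      (ratio-arith b C α g n′ ∣ s t′ u - s t′ v ∣ α≤Cn (≤-trans (m≤m+n g 9) p≤n) (+-cancelʳ-≤ 9 (b * (C + 38)) g big)
                   (gap-bound α (magic u v)))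
    where
    open Swap n′ t g m I decomposition long thin
    positive : 0 < 2 * (g + 9) * (2 + n′)
    positive = subst (0 <_) (sym (expand g n′)) (s≤s z≤n)
      where
      expand : ∀ g n′ → 2 * (g + 9) * (2 + n′) ≡ 1 + (35 + 4 * g + 18 * n′ + 2 * g * n′)
      expand = solve-∀

Eventually : (ℕ → Set) → Set
Eventually P = ∃ λ N → ∀ n → N ≤ n → P n

eventually-× : ∀ {P Q : ℕ → Set} → Eventually P → Eventually Q → Eventually (λ n → P n × Q n)
eventually-× (N , P-after) (M , Q-after) =
  N ⊔ M , λ n N⊔M≤n → P-after n (≤-trans (m≤m⊔n N M) N⊔M≤n) , Q-after n (≤-trans (m≤n⊔m N M) N⊔M≤n)

eventually⇒unbounded : ∀ {P : ℕ → Set} → Eventually P → ∀ N → ∃ λ n → N ≤ n × P n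
eventually⇒unbounded (M , P-after) N = N ⊔ M , m≤m⊔n N M , P-after (N ⊔ M) (m≤n⊔m N M)

open import Data.Integer using (+_)

corollary5p3 : (α : ℕ → ℕ) → BigOn α →
  (p : ℕ → ℕ) → Admissible p →
  (t : (n : ℕ) → Labeling n) → (∀ n → AlmostSupermagic (α n) (t n)) →
  (∀ n → ∃ λ m → ∃ λ (I : Fin m → Interval) → IsDecomposition n m I
     × (∀ i → 4 * p n ≤ len (I i))
     × (∀ (v : Fin n) i → countSI (t n) v (I i) ≤ 2)) →
  (h : ℕ) → .{{_ : NonZero h}} →
  ∃ λ (pstar : ℕ → ℕ) →
    (∀ n → (p n + 1 ≤ pstar n + h) × (pstar n ≤ p n))
    × rAtLeast pstar t (1ℚ Data.Rational.- (+ 3 / 2) Data.Rational.* (+ 1 / h))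
corollary5p3 α (C , α=O[n]) p (p=o[n] , p→∞) t magic thin h =
  p , (λ n → +-monoʳ-≤ (p n) (ℕ.>-nonZero⁻¹ h) , ≤-refl) , ratio
  where
  c : ℚ
  c = 1ℚ Data.Rational.- (+ 3 / 2) Data.Rational.* (+ 1 / h)
  c≤1 : c ℚ.≤ 1ℚ
  c≤1 = 1-x≤1 ((+ 3 / 2) Data.Rational.* (+ 1 / h)) (ℚP.nonNeg*nonNeg⇒nonNeg (+ 3 / 2) (+ 1 / h) {{ℚP.normalize-nonNeg 1 h}})
  ratio : rAtLeast p t c
  ratio ε ε>0 N with ratio-threshold c ε c≤1 ε>0
  ... | b , threshold with eventually⇒unbounded (eventually-× (eventually-× α=O[n] (p=o[n] 1 _)) (p→∞ (b * (C + 38) + 9))) N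
  ...   | n , N≤n , (α≤Cn , p≤n) , big =
    n , N≤n , swap-ratio {c} {ε} b threshold C (t n) (α n) (p n) (magic n) (thin n) α≤Cn (subst (_≤ n) (*-identityˡ (p n)) p≤n) big
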